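{- Let $p$ be an odd prime, $q$ a power of $p$, $k$ an integer with $0\le k\le p-1$, and $n>0$ an integer. Define $$f_{n,k}(x)=k\sum_{j\ge0}\binom{n-1}{2j+1}(x^j-x^{j+1})+2\sum_{j\ge0}\binom{n}{2j}x^j\in\mathbb{Z}[x].$$ Then in $\mathbb{F}_q[x]$, $$D_{n,k}(1,x)=\Big(\frac12\Big)^n f_{n,k}(1-4x),$$ where $f_{n,k}$ is reduced mod $p$. In particular, $D_{n,k}(1,x)$ is a permutation polynomial of $\mathbb{F}_q$ if and only if $f_{n,k}(x)$ is a permutation polynomial of $\mathbb{F}_q$.
   Context: For an integer $n\ge1$, $D_{n,k}(1,x)=\sum_{i=0}^{\lfloor n/2\rfloor}\frac{n-ki}{n-i}\binom{n-i}{i}(-x)^i\in\mathbb{F}_q[x]$ (the coefficients are integers, reduced mod $p$). A permutation polynomial of $\mathbb{F}_q$ is a polynomial inducing a bijection of $\mathbb{F}_q$. -}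

module Defs where

open import Level using (Level; _⊔_)
open import Data.Nat as ℕ using (ℕ; zero; suc; ⌊_/2⌋)
open import Data.Nat.Combinatorics using (_C_)
open import Data.Integer as ℤ using (ℤ; +_; -[1+_])
open import Data.Integer.DivMod using (_/ℕ_)
open import Data.List using (List; []; _∷_; map; foldr; replicate; _++_; upTo)
open import Data.Fin using (Fin)
open import Data.Product using (Σ; ∃; _×_)
open import Relation.Binary.PropositionalEquality using (_≡_)
open import Relation.Nullary using (¬_)
open import Algebra.Bundles using (CommutativeRing)

-- Polynomials as coefficient lists (constant term first), over any
-- carrier with 0, +, *.

module Poly {a} (A : Set a) (0a : A) (_+_ _*_ : A → A → A) where

  coeff : List A → ℕ → A
  coeff []       _       = 0a
  coeff (c ∷ cs) zero    = c
  coeff (c ∷ cs) (suc i) = coeff cs i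

  infixl 6 _+ᴾ_
  _+ᴾ_ : List A → List A → List A
  []       +ᴾ qs       = qs
  (p ∷ ps) +ᴾ []       = p ∷ ps
  (p ∷ ps) +ᴾ (q ∷ qs) = (p + q) ∷ (ps +ᴾ qs)

  scale : A → List A → List A
  scale c = map (c *_)

  infixl 7 _*ᴾ_
  _*ᴾ_ : List A → List A → List A
  []       *ᴾ qs = []
  (p ∷ ps) *ᴾ qs = scale p qs +ᴾ (0a ∷ (ps *ᴾ qs))

  compose : List A → List A → List A
  compose ps g = foldr (λ c acc → (c ∷ []) +ᴾ (g *ᴾ acc)) [] ps

  eval : List A → A → A
  eval ps x = foldr (λ c acc → c + (x * acc)) 0a ps

  sumᴾ : List (List A) → List A
  sumᴾ = foldr _+ᴾ_ []

module PZ = Poly ℤ (+ 0) ℤ._+_ ℤ._*_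

monoZ : ℤ → ℕ → List ℤ
monoZ c j = replicate j (+ 0) ++ (c ∷ [])

-- the integer (n - k i)/(n - i) · binom(n-i, i)  (exact division;
-- n - i ≥ 1 whenever n ≥ 1 and i ≤ ⌊n/2⌋, the zero branch is unused)
Dcoeff : ℕ → ℕ → ℕ → ℤ
Dcoeff n k i with n ℕ.∸ i
... | zero  = + 0
... | suc m = ((+ n ℤ.- (+ k ℤ.* + i)) ℤ.* + ((n ℕ.∸ i) C i)) /ℕ suc m

DZ : ℕ → ℕ → List ℤ
DZ n k = PZ.sumᴾ (map (λ i → monoZ ((ℤ.- + 1) ℤ.^ i ℤ.* Dcoeff n k i) i)
                      (upTo (suc ⌊ n /2⌋)))

-- f_{n,k}(x) = k Σ_{j≥0} binom(n-1,2j+1)(x^j - x^{j+1}) + 2 Σ_{j≥0} binom(n,2j) x^j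
-- (terms with j > n vanish, so summing j = 0..n is the full sum)
fZ : ℕ → ℕ → List ℤ
fZ n k =
  PZ.scale (+ k)
    (PZ.sumᴾ (map (λ j → monoZ (+ ((n ℕ.∸ 1) C (1 ℕ.+ 2 ℕ.* j))) j
                          PZ.+ᴾ monoZ (ℤ.- + ((n ℕ.∸ 1) C (1 ℕ.+ 2 ℕ.* j))) (suc j))
                  (upTo (suc n))))
  PZ.+ᴾ
  PZ.scale (+ 2) (PZ.sumᴾ (map (λ j → monoZ (+ (n C (2 ℕ.* j))) j) (upTo (suc n))))

module OverRing {c ℓ} (R : CommutativeRing c ℓ) where
  open CommutativeRing R

  module PR = Poly Carrier 0# _+_ _*_

  -- canonical ring map ℕ → R and ℤ → R ("reduction mod p")
  ιℕ : ℕ → Carrier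
  ιℕ zero    = 0#
  ιℕ (suc n) = 1# + ιℕ n

  ι : ℤ → Carrier
  ι (+ n)     = ιℕ n
  ι -[1+ n ]  = - ιℕ (suc n)

  reduce : List ℤ → List Carrier
  reduce = map ι

  _≈ᴾ_ : List Carrier → List Carrier → Set ℓ
  P ≈ᴾ Q = ∀ i → PR.coeff P i ≈ PR.coeff Q i

  pow : Carrier → ℕ → Carrier
  pow h zero    = 1#
  pow h (suc n) = h * pow h n

  IsPermutationPolynomial : List Carrier → Set (c ⊔ ℓ)
  IsPermutationPolynomial P =
    (∀ x y → PR.eval P x ≈ PR.eval P y → x ≈ y) ×
    (∀ y → ∃ λ x → PR.eval P x ≈ y)

  record IsFiniteFieldOfOrder (q : ℕ) : Set (c ⊔ ℓ) where
    field
      nontrivial : ¬ (1# ≈ 0#)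
      inverse    : ∀ x → ¬ (x ≈ 0#) → ∃ λ y → x * y ≈ 1#
      enum       : Fin q → Carrier
      enum-onto  : ∀ x → ∃ λ i → x ≈ enum i
      enum-inj   : ∀ i j → enum i ≈ enum j → i ≡ j

-- Both sides satisfy the same three-term recurrence in n.  For the Dickson polynomials of the
-- second kind E_n, Pascal's rule gives E_{n+2} = E_{n+1} - x E_n, and the closed form of the
-- coefficients (an exact division) gives D_{n,k} = E_n + (k - 1) x E_{n-2}; hence
-- D_{n+2,k} = D_{n+1,k} - x D_{n,k}, and 2^n D_{n,k} satisfies X_{n+2} = 2 X_{n+1} - 4x X_n.
-- The even and odd binomial sections Σ C(n,2j) y^j and Σ C(n,2j+1) y^j, and with them f_{n,k},
-- satisfy Y_{n+2} = 2 Y_{n+1} - (1 - y) Y_n (second differences of Pascal's rule), so f_{n,k}(1 - 4x)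
-- satisfies the recurrence of 2^n D_{n,k}; the two agree for n = 1, 2.  This proves the identity
-- over ℤ, and it survives reduction into the field.  As q is odd, 2 is invertible there, so D_{n,k}
-- is a unit multiple of f_{n,k} composed with the bijection x ↦ 1 - 4x, and one is a permutation
-- polynomial iff the other is.

{-# OPTIONS --safe #-}
module Submission where

open import Defs
open import Data.Nat using (ℕ; zero; suc; z≤n; s≤s; _<_)
open import Data.Nat.Primality using (Prime)
open import Data.Integer using (-[1+_])
open import Data.List using (_∷_; [])
open import Data.Product using (∃; _×_; _,_; proj₁; proj₂)
open import Relation.Binary.PropositionalEquality using (_≡_; _≢_)
open import Function.Bundles using (_⇔_)
open import Algebra.Bundles using (CommutativeRing)

module Binomial where
  open import Relation.Binary.PropositionalEquality
  open import Data.Nat using (_+_; _*_; _∸_; _≤_)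
  import Data.Nat.Properties as ℕₚ
  open import Data.Nat.Combinatorics using (_C_; nCk+nC[k+1]≡[n+1]C[k+1])
  open import Data.Nat.Tactic.RingSolver using (solve-∀)

  -- Pascal's rule holds by definition, unlike for Data.Nat.Combinatorics._C_.
  choose : ℕ → ℕ → ℕ
  choose zero    zero    = 1
  choose zero    (suc k) = 0
  choose (suc n) zero    = 1
  choose (suc n) (suc k) = choose n k + choose n (suc k)

  choose≡C : ∀ n k → choose n k ≡ n C k
  choose≡C zero    zero    = refl
  choose≡C zero    (suc k) = refl
  choose≡C (suc n) zero    = refl
  choose≡C (suc n) (suc k) =
    trans (cong₂ _+_ (choose≡C n k) (choose≡C n (suc k))) (nCk+nC[k+1]≡[n+1]C[k+1] n k)

  choose-zero : ∀ n → choose n 0 ≡ 1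
  choose-zero zero    = refl
  choose-zero (suc n) = refl

  n<k⇒choose≡0 : ∀ {n k} → n < k → choose n k ≡ 0
  n<k⇒choose≡0 {zero}  {suc k} _         = refl
  n<k⇒choose≡0 {suc n} {suc k} (s≤s n<k) =
    cong₂ _+_ (n<k⇒choose≡0 n<k) (n<k⇒choose≡0 (ℕₚ.m<n⇒m<1+n n<k))

  choose-one : ∀ n → choose n 1 ≡ n
  choose-one zero    = refl
  choose-one (suc n) = cong₂ _+_ (choose-zero n) (choose-one n)

  choose-absorb : ∀ n k → suc k * choose (suc n) (suc k) ≡ suc n * choose n k
  choose-absorb n zero = begin
    1 * choose (suc n) 1   ≡⟨ ℕₚ.*-identityˡ _ ⟩
    choose (suc n) 1         ≡⟨ choose-one (suc n) ⟩
    suc n                    ≡⟨ sym (ℕₚ.*-identityʳ _) ⟩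
    suc n * 1              ≡⟨ cong (suc n *_) (sym (choose-zero n)) ⟩
    suc n * choose n 0     ∎
    where open ≡-Reasoning
  choose-absorb zero    (suc k) = ℕₚ.*-zeroʳ (2 + k)
  choose-absorb (suc n) (suc k) = begin
    (2 + k) * (choose (suc n) (suc k) + choose (suc n) (2 + k))
      ≡⟨ ℕₚ.*-distribˡ-+ (2 + k) (choose (suc n) (suc k)) (choose (suc n) (2 + k)) ⟩
    (2 + k) * choose (suc n) (suc k) + (2 + k) * choose (suc n) (2 + k)
      ≡⟨ cong₂ (λ s t → choose (suc n) (suc k) + s + t) (choose-absorb n k) (choose-absorb n (suc k)) ⟩
    choose (suc n) (suc k) + suc n * choose n k + suc n * choose n (suc k)
      ≡⟨ rearrange (choose (suc n) (suc k)) (suc n) (choose n k) (choose n (suc k)) ⟩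
    (2 + n) * choose (suc n) (suc k) ∎
    where
    open ≡-Reasoning
    rearrange : ∀ x s y z → x + s * y + s * z ≡ x + s * (y + z)
    rearrange = solve-∀

  choose-second-difference : ∀ n r →
    choose (2 + n) (2 + r) + choose n (2 + r) ≡ 2 * choose (1 + n) (2 + r) + choose n r
  choose-second-difference n r = rearrange (choose n r) (choose n (1 + r)) (choose n (2 + r))
    where
    rearrange : ∀ a b c → a + b + (b + c) + c ≡ 2 * (b + c) + a
    rearrange = solve-∀

  choose-second-difference-low : ∀ n r → r < 2 →
    choose (2 + n) r + choose n r ≡ 2 * choose (1 + n) r + 0
  choose-second-difference-low n zero    _ = cong suc (choose-zero n)
  choose-second-difference-low n (suc zero) _ =
    trans (cong₂ _+_ (choose-one (2 + n)) (choose-one n))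
          (trans (arith n) (cong (λ t → 2 * t + 0) (sym (choose-one (suc n)))))
    where
    arith : ∀ n → 2 + n + n ≡ 2 * (1 + n) + 0
    arith = solve-∀
  choose-second-difference-low n (suc (suc r)) (s≤s (s≤s ()))

  choose-pascal-∸ : ∀ n j k → j ≤ k →
    choose (suc n ∸ j) (suc k) ≡ choose (n ∸ j) k + choose (n ∸ j) (suc k)
  choose-pascal-∸ n       zero    k       _         = refl
  choose-pascal-∸ zero    (suc j) (suc k) _         = cong (λ a → choose a (2 + k)) (ℕₚ.0∸n≡0 j)
  choose-pascal-∸ (suc n) (suc j) k       (s≤s j≤k) = choose-pascal-∸ n j k (ℕₚ.m≤n⇒m≤1+n j≤k)

open Binomial

module PolynomialAlgebra {c ℓ} (R : CommutativeRing c ℓ) where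
  open CommutativeRing R
  open OverRing R
  open PR
  open import Data.List using (List; map)
  open import Data.List.Relation.Binary.Pointwise using (Pointwise; []; _∷_)
  open import Relation.Binary.Bundles using (Setoid)
  import Relation.Binary.Reasoning.Setoid
  open import Algebra.Properties.CommutativeSemigroup +-commutativeSemigroup using (interchange)
  open import Algebra.Properties.CommutativeSemigroup *-commutativeSemigroup using (x∙yz≈y∙xz)

  private variable
    a b : Carrier
    P P′ Q Q′ G G′ : List Carrier

  -- _≈ᴾ_ wrapped in a record, so that both polynomials can be inferred from the type.
  infix 4 _≃_
  record _≃_ (P Q : List Carrier) : Set ℓ where
    constructor coeffwise
    field ≈ᴾ : P ≈ᴾ Q
  open _≃_ public

  ≃-setoid : Setoid c ℓ
  ≃-setoid = record
    { Carrier       = List Carrier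
    ; _≈_           = _≃_
    ; isEquivalence = record
      { refl  = coeffwise λ i → refl
      ; sym   = λ (coeffwise P≈Q) → coeffwise λ i → sym (P≈Q i)
      ; trans = λ (coeffwise P≈Q) (coeffwise Q≈S) → coeffwise λ i → trans (P≈Q i) (Q≈S i)
      }
    }

  open Setoid ≃-setoid public using () renaming (refl to ≃-refl; sym to ≃-sym; trans to ≃-trans)
  module ≃-Reasoning = Relation.Binary.Reasoning.Setoid ≃-setoid

  ∷-cong : a ≈ b → P ≃ Q → a ∷ P ≃ b ∷ Q
  ∷-cong a≈b (coeffwise P≈Q) = coeffwise λ { zero → a≈b ; (suc i) → P≈Q i }

  ≃-head : ∀ {p q} → p ∷ P ≃ q ∷ Q → p ≈ q
  ≃-head (coeffwise P≈Q) = P≈Q 0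

  ≃-tail : ∀ {p q} → p ∷ P ≃ q ∷ Q → P ≃ Q
  ≃-tail (coeffwise P≈Q) = coeffwise λ i → P≈Q (suc i)

  ≃-tail-zero : ∀ {p} → p ∷ P ≃ [] → P ≃ []
  ≃-tail-zero (coeffwise P≈0) = coeffwise λ i → P≈0 (suc i)

  0∷-zero : P ≃ [] → 0# ∷ P ≃ []
  0∷-zero (coeffwise P≈0) = coeffwise λ { zero → refl ; (suc i) → P≈0 i }

  coeff-+ᴾ : ∀ P Q i → coeff (P +ᴾ Q) i ≈ coeff P i + coeff Q i
  coeff-+ᴾ []       Q        i       = sym (+-identityˡ _)
  coeff-+ᴾ (p ∷ P)  []       i       = sym (+-identityʳ _)
  coeff-+ᴾ (p ∷ P)  (q ∷ Q)  zero    = refl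
  coeff-+ᴾ (p ∷ P)  (q ∷ Q)  (suc i) = coeff-+ᴾ P Q i

  coeff-scale : ∀ a P i → coeff (scale a P) i ≈ a * coeff P i
  coeff-scale a []      i       = sym (zeroʳ a)
  coeff-scale a (p ∷ P) zero    = refl
  coeff-scale a (p ∷ P) (suc i) = coeff-scale a P i

  +ᴾ-cong : P ≃ P′ → Q ≃ Q′ → P +ᴾ Q ≃ P′ +ᴾ Q′
  +ᴾ-cong {P} {P′} {Q} {Q′} (coeffwise P≈P′) (coeffwise Q≈Q′) = coeffwise λ i → begin
    coeff (P +ᴾ Q) i        ≈⟨ coeff-+ᴾ P Q i ⟩
    coeff P i + coeff Q i   ≈⟨ +-cong (P≈P′ i) (Q≈Q′ i) ⟩
    coeff P′ i + coeff Q′ i ≈⟨ coeff-+ᴾ P′ Q′ i ⟨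
    coeff (P′ +ᴾ Q′) i      ∎
    where open Relation.Binary.Reasoning.Setoid setoid

  +ᴾ-congˡ : ∀ P → Q ≃ Q′ → P +ᴾ Q ≃ P +ᴾ Q′
  +ᴾ-congˡ P = +ᴾ-cong ≃-refl

  +ᴾ-identityʳ : ∀ P → P +ᴾ [] ≃ P
  +ᴾ-identityʳ []      = ≃-refl
  +ᴾ-identityʳ (p ∷ P) = ≃-refl

  +ᴾ-interchange : ∀ P Q S T → (P +ᴾ Q) +ᴾ (S +ᴾ T) ≃ (P +ᴾ S) +ᴾ (Q +ᴾ T)
  +ᴾ-interchange P Q S T = coeffwise λ i → begin
    coeff ((P +ᴾ Q) +ᴾ (S +ᴾ T)) i                      ≈⟨ coeff-+ᴾ (P +ᴾ Q) (S +ᴾ T) i ⟩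
    coeff (P +ᴾ Q) i + coeff (S +ᴾ T) i                 ≈⟨ +-cong (coeff-+ᴾ P Q i) (coeff-+ᴾ S T i) ⟩
    (coeff P i + coeff Q i) + (coeff S i + coeff T i)   ≈⟨ interchange _ _ _ _ ⟩
    (coeff P i + coeff S i) + (coeff Q i + coeff T i)   ≈⟨ +-cong (coeff-+ᴾ P S i) (coeff-+ᴾ Q T i) ⟨
    coeff (P +ᴾ S) i + coeff (Q +ᴾ T) i                 ≈⟨ coeff-+ᴾ (P +ᴾ S) (Q +ᴾ T) i ⟨
    coeff ((P +ᴾ S) +ᴾ (Q +ᴾ T)) i                      ∎
    where open Relation.Binary.Reasoning.Setoid setoid

  scale-cong : a ≈ b → P ≃ Q → scale a P ≃ scale b Q
  scale-cong {a} {b} {P} {Q} a≈b (coeffwise P≈Q) = coeffwise λ i →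
    trans (coeff-scale a P i) (trans (*-cong a≈b (P≈Q i)) (sym (coeff-scale b Q i)))

  scale-+ᴾ : ∀ a P Q → scale a (P +ᴾ Q) ≃ scale a P +ᴾ scale a Q
  scale-+ᴾ a P Q = coeffwise λ i → begin
    coeff (scale a (P +ᴾ Q)) i                ≈⟨ coeff-scale a (P +ᴾ Q) i ⟩
    a * coeff (P +ᴾ Q) i                      ≈⟨ *-congˡ (coeff-+ᴾ P Q i) ⟩
    a * (coeff P i + coeff Q i)               ≈⟨ distribˡ a _ _ ⟩
    a * coeff P i + a * coeff Q i             ≈⟨ +-cong (coeff-scale a P i) (coeff-scale a Q i) ⟨
    coeff (scale a P) i + coeff (scale a Q) i ≈⟨ coeff-+ᴾ (scale a P) (scale a Q) i ⟨
    coeff (scale a P +ᴾ scale a Q) i          ∎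
    where open Relation.Binary.Reasoning.Setoid setoid

  scale-comm : ∀ a b P → scale a (scale b P) ≃ scale b (scale a P)
  scale-comm a b P = coeffwise λ i → begin
    coeff (scale a (scale b P)) i  ≈⟨ trans (coeff-scale a (scale b P) i) (*-congˡ (coeff-scale b P i)) ⟩
    a * (b * coeff P i)            ≈⟨ x∙yz≈y∙xz a b _ ⟩
    b * (a * coeff P i)            ≈⟨ trans (coeff-scale b (scale a P) i) (*-congˡ (coeff-scale a P i)) ⟨
    coeff (scale b (scale a P)) i  ∎
    where open Relation.Binary.Reasoning.Setoid setoid

  scale-* : ∀ a b P → scale (a * b) P ≃ scale a (scale b P)
  scale-* a b P = coeffwise λ i → begin
    coeff (scale (a * b) P) i      ≈⟨ coeff-scale (a * b) P i ⟩
    a * b * coeff P i              ≈⟨ *-assoc a b (coeff P i) ⟩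
    a * (b * coeff P i)            ≈⟨ trans (coeff-scale a (scale b P) i) (*-congˡ (coeff-scale b P i)) ⟨
    coeff (scale a (scale b P)) i  ∎
    where open Relation.Binary.Reasoning.Setoid setoid

  scale-identity : ∀ P → scale 1# P ≃ P
  scale-identity P = coeffwise λ i → trans (coeff-scale 1# P i) (*-identityˡ (coeff P i))

  *ᴾ-zeroʳ : ∀ P → P *ᴾ [] ≃ []
  *ᴾ-zeroʳ []      = ≃-refl
  *ᴾ-zeroʳ (p ∷ P) = 0∷-zero (*ᴾ-zeroʳ P)

  *ᴾ-congˡ : ∀ P → Q ≃ Q′ → P *ᴾ Q ≃ P *ᴾ Q′
  *ᴾ-congˡ []      Q≃Q′ = ≃-refl
  *ᴾ-congˡ (p ∷ P) Q≃Q′ = +ᴾ-cong (scale-cong refl Q≃Q′) (∷-cong refl (*ᴾ-congˡ P Q≃Q′))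

  *ᴾ-congʳ : Pointwise _≈_ P P′ → P *ᴾ Q ≃ P′ *ᴾ Q
  *ᴾ-congʳ []            = ≃-refl
  *ᴾ-congʳ (p≈p′ ∷ P≈P′) = +ᴾ-cong (scale-cong p≈p′ ≃-refl) (∷-cong refl (*ᴾ-congʳ P≈P′))

  *ᴾ-distribˡ-+ᴾ : ∀ P Q S → P *ᴾ (Q +ᴾ S) ≃ P *ᴾ Q +ᴾ P *ᴾ S
  *ᴾ-distribˡ-+ᴾ []      Q S = ≃-refl
  *ᴾ-distribˡ-+ᴾ (p ∷ P) Q S = begin
    scale p (Q +ᴾ S) +ᴾ (0# ∷ P *ᴾ (Q +ᴾ S))
      ≈⟨ +ᴾ-cong (scale-+ᴾ p Q S) (∷-cong (sym (+-identityʳ 0#)) (*ᴾ-distribˡ-+ᴾ P Q S)) ⟩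
    (scale p Q +ᴾ scale p S) +ᴾ ((0# ∷ P *ᴾ Q) +ᴾ (0# ∷ P *ᴾ S))
      ≈⟨ +ᴾ-interchange (scale p Q) (scale p S) (0# ∷ P *ᴾ Q) (0# ∷ P *ᴾ S) ⟩
    (p ∷ P) *ᴾ Q +ᴾ (p ∷ P) *ᴾ S ∎
    where open ≃-Reasoning

  *ᴾ-scaleʳ : ∀ P b Q → P *ᴾ scale b Q ≃ scale b (P *ᴾ Q)
  *ᴾ-scaleʳ []      b Q = ≃-refl
  *ᴾ-scaleʳ (p ∷ P) b Q = begin
    scale p (scale b Q) +ᴾ (0# ∷ P *ᴾ scale b Q)
      ≈⟨ +ᴾ-cong (scale-comm p b Q) (∷-cong (sym (zeroʳ b)) (*ᴾ-scaleʳ P b Q)) ⟩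
    scale b (scale p Q) +ᴾ scale b (0# ∷ P *ᴾ Q)
      ≈⟨ scale-+ᴾ b (scale p Q) (0# ∷ P *ᴾ Q) ⟨
    scale b ((p ∷ P) *ᴾ Q) ∎
    where open ≃-Reasoning

  linear-*ᴾ : ∀ a b P → (a ∷ b ∷ []) *ᴾ P ≃ scale a P +ᴾ scale b (0# ∷ P)
  linear-*ᴾ a b P =
    +ᴾ-cong ≃-refl (∷-cong (sym (zeroʳ b)) (≃-trans (+ᴾ-cong ≃-refl (0∷-zero ≃-refl)) (+ᴾ-identityʳ (scale b P))))

  compose-zero : ∀ G → P ≃ [] → compose P G ≃ []
  compose-zero {[]}    G P≃0 = ≃-refl
  compose-zero {p ∷ P} G P≃0@(coeffwise P≈0) = begin
    (p ∷ []) +ᴾ G *ᴾ compose P G   ≈⟨ +ᴾ-cong (∷-cong (P≈0 0) ≃-refl)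
                                              (≃-trans (*ᴾ-congˡ G (compose-zero G (≃-tail-zero P≃0))) (*ᴾ-zeroʳ G)) ⟩
    (0# ∷ []) +ᴾ []                ≈⟨ 0∷-zero ≃-refl ⟩
    []                             ∎
    where open ≃-Reasoning

  compose-congʳ : ∀ G → P ≃ Q → compose P G ≃ compose Q G
  compose-congʳ {[]}    {Q}     G P≃Q = ≃-sym (compose-zero G (≃-sym P≃Q))
  compose-congʳ {p ∷ P} {[]}    G P≃Q = compose-zero G P≃Q
  compose-congʳ {p ∷ P} {q ∷ Q} G P≃Q =
    +ᴾ-cong (∷-cong (≃-head P≃Q) ≃-refl) (*ᴾ-congˡ G (compose-congʳ G (≃-tail P≃Q)))

  compose-congˡ : ∀ P → Pointwise _≈_ G G′ → compose P G ≃ compose P G′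
  compose-congˡ []      G≈G′ = ≃-refl
  compose-congˡ {G} {G′} (p ∷ P) G≈G′ =
    +ᴾ-cong ≃-refl (≃-trans (*ᴾ-congʳ {Q = compose P G} G≈G′) (*ᴾ-congˡ G′ (compose-congˡ P G≈G′)))

  compose-+ᴾ : ∀ P Q G → compose (P +ᴾ Q) G ≃ compose P G +ᴾ compose Q G
  compose-+ᴾ []      Q       G = ≃-refl
  compose-+ᴾ (p ∷ P) []      G = ≃-sym (+ᴾ-identityʳ (compose (p ∷ P) G))
  compose-+ᴾ (p ∷ P) (q ∷ Q) G = begin
    ((p + q) ∷ []) +ᴾ G *ᴾ compose (P +ᴾ Q) G
      ≈⟨ +ᴾ-cong ≃-refl (≃-trans (*ᴾ-congˡ G (compose-+ᴾ P Q G)) (*ᴾ-distribˡ-+ᴾ G (compose P G) (compose Q G))) ⟩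
    ((p ∷ []) +ᴾ (q ∷ [])) +ᴾ (G *ᴾ compose P G +ᴾ G *ᴾ compose Q G)
      ≈⟨ +ᴾ-interchange (p ∷ []) (q ∷ []) (G *ᴾ compose P G) (G *ᴾ compose Q G) ⟩
    compose (p ∷ P) G +ᴾ compose (q ∷ Q) G ∎
    where open ≃-Reasoning

  compose-scale : ∀ b P G → compose (scale b P) G ≃ scale b (compose P G)
  compose-scale b []      G = ≃-refl
  compose-scale b (p ∷ P) G = begin
    ((b * p) ∷ []) +ᴾ G *ᴾ compose (scale b P) G
      ≈⟨ +ᴾ-cong ≃-refl (≃-trans (*ᴾ-congˡ G (compose-scale b P G)) (*ᴾ-scaleʳ G b (compose P G))) ⟩
    scale b (p ∷ []) +ᴾ scale b (G *ᴾ compose P G)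
      ≈⟨ scale-+ᴾ b (p ∷ []) (G *ᴾ compose P G) ⟨
    scale b (compose (p ∷ P) G) ∎
    where open ≃-Reasoning

  compose-0∷ : ∀ P G → compose (0# ∷ P) G ≃ G *ᴾ compose P G
  compose-0∷ P G = +ᴾ-cong (0∷-zero ≃-refl) ≃-refl

  compose-step : ∀ a P₁ b P₀ c G →
    compose (scale a P₁ +ᴾ scale b P₀ +ᴾ scale c (0# ∷ P₀)) G
      ≃ scale a (compose P₁ G) +ᴾ scale b (compose P₀ G) +ᴾ scale c (G *ᴾ compose P₀ G)
  compose-step a P₁ b P₀ c G = begin
    compose (scale a P₁ +ᴾ scale b P₀ +ᴾ scale c (0# ∷ P₀)) G
      ≈⟨ compose-+ᴾ (scale a P₁ +ᴾ scale b P₀) (scale c (0# ∷ P₀)) G ⟩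
    compose (scale a P₁ +ᴾ scale b P₀) G +ᴾ compose (scale c (0# ∷ P₀)) G
      ≈⟨ +ᴾ-cong (compose-+ᴾ (scale a P₁) (scale b P₀) G) (compose-scale c (0# ∷ P₀) G) ⟩
    compose (scale a P₁) G +ᴾ compose (scale b P₀) G +ᴾ scale c (compose (0# ∷ P₀) G)
      ≈⟨ +ᴾ-cong (+ᴾ-cong (compose-scale a P₁ G) (compose-scale b P₀ G)) (scale-cong refl (compose-0∷ P₀ G)) ⟩
    scale a (compose P₁ G) +ᴾ scale b (compose P₀ G) +ᴾ scale c (G *ᴾ compose P₀ G) ∎
    where open ≃-Reasoning

  sumᴾ-+ᴾ : ∀ {A : Set} (F F′ : A → List Carrier) xs →
    sumᴾ (map (λ x → F x +ᴾ F′ x) xs) ≃ sumᴾ (map F xs) +ᴾ sumᴾ (map F′ xs)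
  sumᴾ-+ᴾ F F′ []       = ≃-refl
  sumᴾ-+ᴾ F F′ (x ∷ xs) =
    ≃-trans (+ᴾ-cong ≃-refl (sumᴾ-+ᴾ F F′ xs))
            (+ᴾ-interchange (F x) (F′ x) (sumᴾ (map F xs)) (sumᴾ (map F′ xs)))

  sumᴾ-0∷ : ∀ {A : Set} (F : A → List Carrier) xs → sumᴾ (map (λ x → 0# ∷ F x) xs) ≃ 0# ∷ sumᴾ (map F xs)
  sumᴾ-0∷ F []       = ≃-sym (0∷-zero ≃-refl)
  sumᴾ-0∷ F (x ∷ xs) = ≃-trans (+ᴾ-cong ≃-refl (sumᴾ-0∷ F xs)) (∷-cong (+-identityʳ 0#) ≃-refl)

module Recurrences where
  open import Relation.Binary.PropositionalEquality
  open import Data.Nat as ℕ using ()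
  open import Data.Integer using (ℤ; +_; _+_; _*_; -_; _^_)
  import Data.Integer.Properties as ℤₚ
  open import Data.Integer.Tactic.RingSolver using (solve-∀)

  shift : (ℕ → ℤ) → ℕ → ℤ
  shift f zero    = + 0
  shift f (suc i) = f i

  -- X m i is the coefficient of x^i in P_m, where P_{m+2} = a P_{m+1} + (b + c x) P_m.
  record Recurrence (a b c : ℤ) (X : ℕ → ℕ → ℤ) : Set where
    field
      recur : ∀ m i → X (2 ℕ.+ m) i ≡ a * X (1 ℕ.+ m) i + b * X m i + c * shift (X m) i
  open Recurrence public

  private variable
    a b c : ℤ
    X Y : ℕ → ℕ → ℤ

  shift-cong : ∀ {f g} → (∀ i → f i ≡ g i) → ∀ i → shift f i ≡ shift g i
  shift-cong f≡g zero    = refl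
  shift-cong f≡g (suc i) = f≡g i

  shift-+ : ∀ f g i → shift (λ j → f j + g j) i ≡ shift f i + shift g i
  shift-+ f g zero    = refl
  shift-+ f g (suc i) = refl

  shift-neg : ∀ f i → shift (λ j → - f j) i ≡ - shift f i
  shift-neg f zero    = refl
  shift-neg f (suc i) = refl

  shift-* : ∀ s f i → shift (λ j → s * f j) i ≡ s * shift f i
  shift-* s f zero    = sym (ℤₚ.*-zeroʳ s)
  shift-* s f (suc i) = refl

  rhs-cong : ∀ {f₁ g₁ f₀ g₀ : ℕ → ℤ} → (∀ i → f₁ i ≡ g₁ i) → (∀ i → f₀ i ≡ g₀ i) →
    ∀ i → a * f₁ i + b * f₀ i + c * shift f₀ i ≡ a * g₁ i + b * g₀ i + c * shift g₀ i
  rhs-cong {a} {b} {c} f₁≡g₁ f₀≡g₀ i =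
    cong₂ (λ s t → s + c * t) (cong₂ (λ s t → a * s + b * t) (f₁≡g₁ i) (f₀≡g₀ i)) (shift-cong f₀≡g₀ i)

  recurrence-cong : (∀ m i → X m i ≡ Y m i) → Recurrence a b c X → Recurrence a b c Y
  recurrence-cong {a = a} {b} {c} X≡Y rX .recur m i =
    trans (sym (X≡Y (2 ℕ.+ m) i)) (trans (recur rX m i) (rhs-cong {a} {b} {c} (X≡Y (1 ℕ.+ m)) (X≡Y m) i))

  recurrence-+ : Recurrence a b c X → Recurrence a b c Y → Recurrence a b c (λ m i → X m i + Y m i)
  recurrence-+ {a} {b} {c} {X} {Y} rX rY .recur m i
    rewrite recur rX m i | recur rY m i | shift-+ (X m) (Y m) i = distrib a b c _ _ _ _ _ _
    where
    distrib : ∀ a b c x₁ y₁ x₀ y₀ s t →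
      a * x₁ + b * x₀ + c * s + (a * y₁ + b * y₀ + c * t) ≡ a * (x₁ + y₁) + b * (x₀ + y₀) + c * (s + t)
    distrib = solve-∀

  recurrence-neg : Recurrence a b c X → Recurrence a b c (λ m i → - X m i)
  recurrence-neg {a} {b} {c} {X} rX .recur m i
    rewrite recur rX m i | shift-neg (X m) i = distrib a b c _ _ _
    where
    distrib : ∀ a b c x₁ x₀ s → - (a * x₁ + b * x₀ + c * s) ≡ a * - x₁ + b * - x₀ + c * - s
    distrib = solve-∀

  recurrence-scale : ∀ r → Recurrence a b c X → Recurrence a b c (λ m i → r * X m i)
  recurrence-scale {a} {b} {c} {X} r rX .recur m i
    rewrite recur rX m i | shift-* r (X m) i = distrib a b c r _ _ _
    where
    distrib : ∀ a b c r x₁ x₀ s → r * (a * x₁ + b * x₀ + c * s) ≡ a * (r * x₁) + b * (r * x₀) + c * (r * s)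
    distrib = solve-∀

  recurrence-shift : Recurrence a b c X → Recurrence a b c (λ m → shift (X m))
  recurrence-shift {a} {b} {c} rX .recur m zero    = sym (annihilate a b c)
    where
    annihilate : ∀ a b c → a * + 0 + b * + 0 + c * + 0 ≡ + 0
    annihilate = solve-∀
  recurrence-shift rX .recur m (suc i) = recur rX m i

  recurrence-suc : Recurrence a b c X → Recurrence a b c (λ m → X (suc m))
  recurrence-suc rX .recur m = recur rX (suc m)

  recurrence-geometric : ∀ r → Recurrence a b c X →
    Recurrence (r * a) (r * r * b) (r * r * c) (λ m i → r ^ m * X m i)
  recurrence-geometric {a} {b} {c} {X} r rX .recur m i
    rewrite recur rX m i | shift-* (r ^ m) (X m) i = distrib a b c r (r ^ m) _ _ _
    where
    distrib : ∀ a b c r p x₁ x₀ s →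
      r * (r * p) * (a * x₁ + b * x₀ + c * s) ≡ r * a * (r * p * x₁) + r * r * b * (p * x₀) + r * r * c * (p * s)
    distrib = solve-∀

  recurrence-unique : Recurrence a b c X → Recurrence a b c Y →
    (∀ i → X 0 i ≡ Y 0 i) → (∀ i → X 1 i ≡ Y 1 i) → ∀ m i → X m i ≡ Y m i
  recurrence-unique rX rY X₀≡Y₀ X₁≡Y₁ zero          = X₀≡Y₀
  recurrence-unique rX rY X₀≡Y₀ X₁≡Y₁ (suc zero)    = X₁≡Y₁
  recurrence-unique {a} {b} {c} {X} {Y} rX rY X₀≡Y₀ X₁≡Y₁ (suc (suc m)) i =
    trans (recur rX m i) (trans (rhs-cong {a} {b} {c} (agree (suc m)) (agree m) i) (sym (recur rY m i)))
    where
    agree : ∀ m i → X m i ≡ Y m i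
    agree = recurrence-unique {a} {b} {c} {X} {Y} rX rY X₀≡Y₀ X₁≡Y₁

open Recurrences

module Coefficients where
  open import Relation.Binary.PropositionalEquality
  open import Data.Nat as ℕ using ()
  import Data.Nat.Properties as ℕₚ
  open import Data.Integer using (ℤ; +_; -1ℤ; _+_; _*_; _-_; -_; _^_)
  import Data.Integer.Properties as ℤₚ
  open import Data.Integer.Tactic.RingSolver using (solve-∀)

  recurrence-from-ℕ : ∀ {x₂ x₁ x₀ s} → x₂ ℕ.+ x₀ ≡ 2 ℕ.* x₁ ℕ.+ s →
    + x₂ ≡ + 2 * + x₁ + -1ℤ * + x₀ + + 1 * + s
  recurrence-from-ℕ {x₂} {x₁} {x₀} {s} eq = begin
    + x₂                          ≡⟨ cancel (+ x₂) (+ x₀) ⟩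
    (+ x₂ + + x₀) - + x₀          ≡⟨ cong (_- + x₀) (sym (ℤₚ.pos-+ x₂ x₀)) ⟩
    + (x₂ ℕ.+ x₀) - + x₀          ≡⟨ cong (λ t → + t - + x₀) eq ⟩
    + (2 ℕ.* x₁ ℕ.+ s) - + x₀     ≡⟨ cong (_- + x₀) (trans (ℤₚ.pos-+ (2 ℕ.* x₁) s)
                                                           (cong (_+ + s) (ℤₚ.pos-* 2 x₁))) ⟩
    + 2 * + x₁ + + s - + x₀       ≡⟨ rearrange (+ 2 * + x₁) (+ x₀) (+ s) ⟩
    + 2 * + x₁ + -1ℤ * + x₀ + + 1 * + s ∎
    where
    open ≡-Reasoning
    cancel : ∀ x y → x ≡ (x + y) - y
    cancel = solve-∀
    rearrange : ∀ x y z → x + z - y ≡ x + -1ℤ * y + + 1 * z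
    rearrange = solve-∀

  binomialSection : (ℕ → ℕ) → ℕ → ℕ → ℤ
  binomialSection ρ m j = + choose m (ρ j)

  binomialSection-recurrence : ∀ ρ → (∀ j → ρ (suc j) ≡ 2 ℕ.+ ρ j) → ρ 0 < 2 →
    Recurrence (+ 2) -1ℤ (+ 1) (binomialSection ρ)
  binomialSection-recurrence ρ step ρ₀<2 .recur m zero =
    recurrence-from-ℕ {x₁ = choose (1 ℕ.+ m) (ρ 0)} {x₀ = choose m (ρ 0)} {s = 0}
      (choose-second-difference-low m (ρ 0) ρ₀<2)
  binomialSection-recurrence ρ step ρ₀<2 .recur m (suc j) rewrite step j =
    recurrence-from-ℕ {x₁ = choose (1 ℕ.+ m) (2 ℕ.+ ρ j)} {x₀ = choose m (2 ℕ.+ ρ j)} {s = choose m (ρ j)}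
      (choose-second-difference m (ρ j))

  evenBinomials oddBinomials : ℕ → ℕ → ℤ
  evenBinomials = binomialSection (2 ℕ.*_)
  oddBinomials  = binomialSection (λ j → suc (2 ℕ.* j))

  evenBinomials-recurrence : Recurrence (+ 2) -1ℤ (+ 1) evenBinomials
  evenBinomials-recurrence = binomialSection-recurrence (2 ℕ.*_) (ℕₚ.*-suc 2) (s≤s z≤n)

  oddBinomials-recurrence : Recurrence (+ 2) -1ℤ (+ 1) oddBinomials
  oddBinomials-recurrence =
    binomialSection-recurrence (λ j → suc (2 ℕ.* j)) (λ j → cong suc (ℕₚ.*-suc 2 j)) (s≤s (s≤s z≤n))

  -- The coefficients of f_{m+1,k}.
  fCoefficient : ℕ → ℕ → ℕ → ℤ
  fCoefficient k m i = + k * (oddBinomials m i - shift (oddBinomials m) i) + + 2 * evenBinomials (suc m) i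

  fCoefficient-recurrence : ∀ k → Recurrence (+ 2) -1ℤ (+ 1) (fCoefficient k)
  fCoefficient-recurrence k =
    recurrence-+ {X = λ m i → + k * (oddBinomials m i - shift (oddBinomials m) i)}
                 {Y = λ m i → + 2 * evenBinomials (suc m) i}
      (recurrence-scale (+ k) (recurrence-+ {X = oddBinomials} {Y = λ m i → - shift (oddBinomials m) i}
                                            oddBinomials-recurrence
                                            (recurrence-neg (recurrence-shift oddBinomials-recurrence))))
      (recurrence-scale (+ 2) (recurrence-suc evenBinomials-recurrence))

  -- dicksonE (suc n) holds the coefficients of the Dickson polynomial of the second kind
  -- E_n(x) = Σ C(n-i, i) (-x)^i, and dicksonE 0 those of E_{-1} = 0.
  dicksonE : ℕ → ℕ → ℤ
  dicksonE zero    i = + 0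
  dicksonE (suc n) i = -1ℤ ^ i * + choose (n ℕ.∸ i) i

  dicksonE-recurrence : Recurrence (+ 1) (+ 0) -1ℤ dicksonE
  dicksonE-recurrence .recur zero    zero    = refl
  dicksonE-recurrence .recur zero    (suc j) rewrite ℕₚ.0∸n≡0 j = vanish (-1ℤ ^ j)
    where
    vanish : ∀ s → -1ℤ * s * + 0 ≡ + 1 * (-1ℤ * s * + 0) + + 0 + -1ℤ * + 0
    vanish = solve-∀
  dicksonE-recurrence .recur (suc m) zero    = refl
  dicksonE-recurrence .recur (suc m) (suc j)
    rewrite choose-pascal-∸ m j j ℕₚ.≤-refl | ℤₚ.pos-+ (choose (m ℕ.∸ j) j) (choose (m ℕ.∸ j) (suc j))
    = pascal (-1ℤ ^ j) _ _
    where
    pascal : ∀ s x y → -1ℤ * s * (x + y) ≡ + 1 * (-1ℤ * s * y) + + 0 + -1ℤ * (s * x)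
    pascal = solve-∀

  -- The coefficients of D_{m+1,k} = E_{m+1} + (k-1) x E_{m-1}.
  dicksonD : ℕ → ℕ → ℕ → ℤ
  dicksonD k m i = dicksonE (2 ℕ.+ m) i + (+ k - + 1) * shift (dicksonE m) i

  dicksonD-recurrence : ∀ k → Recurrence (+ 1) (+ 0) -1ℤ (dicksonD k)
  dicksonD-recurrence k =
    recurrence-+ {X = λ m → dicksonE (2 ℕ.+ m)} {Y = λ m i → (+ k - + 1) * shift (dicksonE m) i}
      (recurrence-suc (recurrence-suc dicksonE-recurrence))
      (recurrence-scale (+ k - + 1) (recurrence-shift dicksonE-recurrence))

open Coefficients

module IntegerIdentity where
  open import Relation.Binary.PropositionalEquality
  open import Data.Nat as ℕ using (_≤_; _≤?_; ⌊_/2⌋)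
  import Data.Nat.Properties as ℕₚ
  import Data.Nat.DivMod as ℕ
  open import Data.Nat.Combinatorics using (_C_)
  open import Data.Integer using (ℤ; +_; -1ℤ; _+_; _*_; _-_; -_; _^_; _/ℕ_)
  import Data.Integer.Properties as ℤₚ
  open import Data.Integer.Tactic.RingSolver using (solve-∀)
  open import Data.List using (List; map; upTo; applyUpTo)
  import Data.List.Properties as Listₚ
  open import Relation.Nullary using (yes; no)
  open import Function.Base using (id; _∘_)

  open PolynomialAlgebra ℤₚ.+-*-commutativeRing
  open PZ using (coeff; _+ᴾ_; _*ᴾ_; scale; compose; sumᴾ)

  coeff-0∷ : ∀ P i → coeff (+ 0 ∷ P) i ≡ shift (coeff P) i
  coeff-0∷ P zero    = refl
  coeff-0∷ P (suc i) = refl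

  n<k⇒C≡0 : ∀ {n k} → n < k → n C k ≡ 0
  n<k⇒C≡0 {n} {k} n<k = trans (sym (choose≡C n k)) (n<k⇒choose≡0 n<k)

  coeff-monomials : ∀ N (a : ℕ → ℤ) → (∀ j → N ≤ j → a j ≡ + 0) →
    ∀ i → coeff (sumᴾ (map (λ j → monoZ (a j) j) (upTo N))) i ≡ a i
  coeff-monomials zero    a vanish i = sym (vanish i z≤n)
  coeff-monomials (suc N) a vanish i = begin
    coeff ((a 0 ∷ []) +ᴾ sumᴾ (map monomial (applyUpTo suc N))) i
      ≡⟨ cong (λ L → coeff ((a 0 ∷ []) +ᴾ sumᴾ L) i)
              (trans (Listₚ.map-applyUpTo suc monomial N) (sym (Listₚ.map-upTo (λ j → monomial (suc j)) N))) ⟩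
    coeff ((a 0 ∷ []) +ᴾ sumᴾ (map (λ j → + 0 ∷ monoZ (a (suc j)) j) (upTo N))) i
      ≡⟨ ≈ᴾ (+ᴾ-congˡ (a 0 ∷ []) (sumᴾ-0∷ (λ j → monoZ (a (suc j)) j) (upTo N))) i ⟩
    coeff (a 0 + + 0 ∷ sumᴾ (map (λ j → monoZ (a (suc j)) j) (upTo N))) i
      ≡⟨ head-and-tail i ⟩
    a i ∎
    where
    open ≡-Reasoning
    monomial : ℕ → List ℤ
    monomial j = monoZ (a j) j
    head-and-tail : ∀ i → coeff (a 0 + + 0 ∷ sumᴾ (map (λ j → monoZ (a (suc j)) j) (upTo N))) i ≡ a i
    head-and-tail zero    = ℤₚ.+-identityʳ (a 0)
    head-and-tail (suc i) = coeff-monomials N (λ j → a (suc j)) (λ j N≤j → vanish (suc j) (s≤s N≤j)) i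

  coeff-binomials : ∀ n ρ N (σ : ℤ → ℤ) → σ (+ 0) ≡ + 0 → (∀ j → N ≤ j → n < ρ j) →
    ∀ i → coeff (sumᴾ (map (λ j → monoZ (σ (+ (n C ρ j))) j) (upTo N))) i ≡ σ (binomialSection ρ n i)
  coeff-binomials n ρ N σ σ0≡0 n<ρ i =
    trans (coeff-monomials N (λ j → σ (+ (n C ρ j))) (λ j N≤j → trans (cong (σ ∘ +_) (n<k⇒C≡0 (n<ρ j N≤j))) σ0≡0) i)
          (cong (σ ∘ +_) (sym (choose≡C n (ρ i))))

  m<2j+1 : ∀ {m j} → 2 ℕ.+ m ≤ j → m < suc (2 ℕ.* j)
  m<2j+1 {m} {j} m+2≤j = s≤s (ℕₚ.≤-trans (ℕₚ.m+n≤o⇒n≤o 2 m+2≤j) (ℕₚ.m≤n*m j 2))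

  m+1<2j : ∀ {m j} → 2 ℕ.+ m ≤ j → suc m < 2 ℕ.* j
  m+1<2j {m} {j} m+2≤j = ℕₚ.≤-trans m+2≤j (ℕₚ.m≤n*m j 2)

  coeff-oddPart : ∀ m i →
    coeff (sumᴾ (map (λ j → monoZ (+ (m C suc (2 ℕ.* j))) j +ᴾ monoZ (- + (m C suc (2 ℕ.* j))) (suc j))
                     (upTo (2 ℕ.+ m)))) i
      ≡ oddBinomials m i - shift (oddBinomials m) i
  coeff-oddPart m i = begin
    coeff (sumᴾ (map (λ j → monoZ (b j) j +ᴾ (+ 0 ∷ monoZ (- b j) j)) L)) i
      ≡⟨ ≈ᴾ (sumᴾ-+ᴾ (λ j → monoZ (b j) j) (λ j → + 0 ∷ monoZ (- b j) j) L) i ⟩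
    coeff (sumᴾ (map (λ j → monoZ (b j) j) L) +ᴾ sumᴾ (map (λ j → + 0 ∷ monoZ (- b j) j) L)) i
      ≡⟨ ≈ᴾ (+ᴾ-congˡ (sumᴾ (map (λ j → monoZ (b j) j) L)) (sumᴾ-0∷ (λ j → monoZ (- b j) j) L)) i ⟩
    coeff (sumᴾ (map (λ j → monoZ (b j) j) L) +ᴾ (+ 0 ∷ sumᴾ (map (λ j → monoZ (- b j) j) L))) i
      ≡⟨ coeff-+ᴾ (sumᴾ (map (λ j → monoZ (b j) j) L)) (+ 0 ∷ sumᴾ (map (λ j → monoZ (- b j) j) L)) i ⟩
    coeff (sumᴾ (map (λ j → monoZ (b j) j) L)) i + coeff (+ 0 ∷ sumᴾ (map (λ j → monoZ (- b j) j) L)) i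
      ≡⟨ cong₂ _+_ (coeff-binomials m ρ (2 ℕ.+ m) id refl (λ j → m<2j+1) i)
                   (trans (coeff-0∷ (sumᴾ (map (λ j → monoZ (- b j) j) L)) i)
                          (shift-cong (coeff-binomials m ρ (2 ℕ.+ m) -_ refl (λ j → m<2j+1)) i)) ⟩
    oddBinomials m i + shift (λ j → - oddBinomials m j) i
      ≡⟨ cong (_+_ (oddBinomials m i)) (shift-neg (oddBinomials m) i) ⟩
    oddBinomials m i - shift (oddBinomials m) i ∎
    where
    open ≡-Reasoning
    L = upTo (2 ℕ.+ m)
    ρ : ℕ → ℕ
    ρ j = suc (2 ℕ.* j)
    b : ℕ → ℤ
    b j = + (m C ρ j)

  coeff-fZ : ∀ k m i → coeff (fZ (suc m) k) i ≡ fCoefficient k m i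
  coeff-fZ k m i = begin
    coeff (scale (+ k) odds +ᴾ scale (+ 2) evens) i
      ≡⟨ coeff-+ᴾ (scale (+ k) odds) (scale (+ 2) evens) i ⟩
    coeff (scale (+ k) odds) i + coeff (scale (+ 2) evens) i
      ≡⟨ cong₂ _+_ (coeff-scale (+ k) odds i) (coeff-scale (+ 2) evens i) ⟩
    + k * coeff odds i + + 2 * coeff evens i
      ≡⟨ cong₂ (λ s t → + k * s + + 2 * t) (coeff-oddPart m i)
               (coeff-binomials (suc m) (2 ℕ.*_) (2 ℕ.+ m) id refl (λ j → m+1<2j) i) ⟩
    fCoefficient k m i ∎
    where
    open ≡-Reasoning
    odds evens : List ℤ
    odds  = sumᴾ (map (λ j → monoZ (+ (m C suc (2 ℕ.* j))) j +ᴾ monoZ (- + (m C suc (2 ℕ.* j))) (suc j))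
                      (upTo (2 ℕ.+ m)))
    evens = sumᴾ (map (λ j → monoZ (+ (suc m C (2 ℕ.* j))) j) (upTo (2 ℕ.+ m)))

  [i*n]/ℕn≡i : ∀ i n → (i * + suc n) /ℕ suc n ≡ i
  [i*n]/ℕn≡i (+ a)    n = trans (cong (_/ℕ suc n) (sym (ℤₚ.pos-* a (suc n)))) (cong +_ (ℕ.m*n/n≡m a (suc n)))
  [i*n]/ℕn≡i -[1+ a ] n with suc (n ℕ.+ a ℕ.* suc n) ℕ.% suc n | ℕ.m*n%n≡0 (suc a) (suc n)
  ... | .0 | refl = cong (λ t → - + t) (ℕ.m*n/n≡m (suc a) (suc n))

  Dcoeff-unfold : ∀ n k i s → n ℕ.∸ i ≡ suc s → Dcoeff n k i ≡ ((+ n - + k * + i) * + (suc s C i)) /ℕ suc s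
  Dcoeff-unfold n k i s eq with n ℕ.∸ i in e
  Dcoeff-unfold n k i s refl | suc s′ rewrite e = refl

  Dcoeff-beyond : ∀ n k i → n ≤ i → Dcoeff n k i ≡ + 0
  Dcoeff-beyond n k i n≤i with n ℕ.∸ i | ℕₚ.m≤n⇒m∸n≡0 n≤i
  ... | .0 | refl = refl

  dicksonE-vanishes : ∀ n i → n ≤ 2 ℕ.* i → dicksonE n i ≡ + 0
  dicksonE-vanishes zero    i       _    = refl
  dicksonE-vanishes (suc n) (suc i) n<2i = begin
    -1ℤ ^ suc i * + choose (n ℕ.∸ suc i) (suc i)  ≡⟨ cong (λ c → -1ℤ ^ suc i * + c) (n<k⇒choose≡0 n∸i<i) ⟩
    -1ℤ ^ suc i * + 0                             ≡⟨ ℤₚ.*-zeroʳ (-1ℤ ^ suc i) ⟩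
    + 0                                           ∎
    where
    open ≡-Reasoning
    n∸i<i : n ℕ.∸ suc i < suc i
    n∸i<i = ℕₚ.m<n+o⇒m∸n<o n (suc i) (subst (n <_) (cong (suc i ℕ.+_) (ℕₚ.+-identityʳ (suc i))) n<2i)

  dicksonD-vanishes : ∀ k m i → 2 ℕ.+ m ≤ 2 ℕ.* i → dicksonD k m i ≡ + 0
  dicksonD-vanishes k m (suc i) m+2≤2i = begin
    dicksonE (2 ℕ.+ m) (suc i) + (+ k - + 1) * dicksonE m i
      ≡⟨ cong₂ (λ s t → s + (+ k - + 1) * t) (dicksonE-vanishes (2 ℕ.+ m) (suc i) m+2≤2i)
               (dicksonE-vanishes m i (ℕₚ.+-cancelˡ-≤ 2 m (2 ℕ.* i) (subst (2 ℕ.+ m ≤_) (ℕₚ.*-suc 2 i) m+2≤2i))) ⟩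
    + 0 + (+ k - + 1) * + 0
      ≡⟨ trans (ℤₚ.+-identityˡ _) (ℤₚ.*-zeroʳ (+ k - + 1)) ⟩
    + 0 ∎
    where open ≡-Reasoning

  -- For i = j + 1 and n - i = s + 1: (n - k i) C(n-i, i) = (n - i) (C(n-i, i) + (1 - k) C(n-i-1, i-1)).
  Dcoeff-numerator : ∀ k s j →
    (+ (2 ℕ.+ s ℕ.+ j) - + k * + suc j) * + choose (suc s) (suc j)
      ≡ (+ choose (suc s) (suc j) + (+ 1 - + k) * + choose s j) * + suc s
  Dcoeff-numerator k s j = begin
    (+ (2 ℕ.+ s ℕ.+ j) - + k * + suc j) * + A
      ≡⟨ cong (λ t → (t - + k * + suc j) * + A)
              (trans (cong (λ t → + suc t) (sym (ℕₚ.+-suc s j))) (ℤₚ.pos-+ (suc s) (suc j))) ⟩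
    (+ suc s + + suc j - + k * + suc j) * + A
      ≡⟨ expand (+ suc s) (+ suc j) (+ k) (+ A) ⟩
    + suc s * + A + + suc j * + A - + k * (+ suc j * + A)
      ≡⟨ cong (λ t → + suc s * + A + t - + k * t) absorb ⟩
    + suc s * + A + + suc s * + B - + k * (+ suc s * + B)
      ≡⟨ collect (+ suc s) (+ k) (+ A) (+ B) ⟩
    (+ A + (+ 1 - + k) * + B) * + suc s ∎
    where
    open ≡-Reasoning
    A = choose (suc s) (suc j)
    B = choose s j
    absorb : + suc j * + A ≡ + suc s * + B
    absorb = trans (sym (ℤₚ.pos-* (suc j) A)) (trans (cong +_ (choose-absorb s j)) (ℤₚ.pos-* (suc s) B))
    expand : ∀ s i k a → (s + i - k * i) * a ≡ s * a + i * a - k * (i * a)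
    expand = solve-∀
    collect : ∀ s k a b → s * a + s * b - k * (s * b) ≡ (a + (+ 1 - k) * b) * s
    collect = solve-∀

  signed-Dcoeff-interior : ∀ k s j {m} → m ≡ suc (s ℕ.+ j) → -1ℤ ^ suc j * Dcoeff (suc m) k (suc j) ≡ dicksonD k m (suc j)
  signed-Dcoeff-interior k s j refl = begin
    σ * Dcoeff (2 ℕ.+ s ℕ.+ j) k (suc j)
      ≡⟨ cong (σ *_) (Dcoeff-unfold (2 ℕ.+ s ℕ.+ j) k (suc j) s (ℕₚ.m+n∸n≡m (suc s) j)) ⟩
    σ * (((+ (2 ℕ.+ s ℕ.+ j) - + k * + suc j) * + (suc s C suc j)) /ℕ suc s)
      ≡⟨ cong (λ c → σ * (((+ (2 ℕ.+ s ℕ.+ j) - + k * + suc j) * + c) /ℕ suc s)) (sym (choose≡C (suc s) (suc j))) ⟩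
    σ * (((+ (2 ℕ.+ s ℕ.+ j) - + k * + suc j) * + choose (suc s) (suc j)) /ℕ suc s)
      ≡⟨ cong (λ t → σ * (t /ℕ suc s)) (Dcoeff-numerator k s j) ⟩
    σ * (((+ choose (suc s) (suc j) + (+ 1 - + k) * + choose s j) * + suc s) /ℕ suc s)
      ≡⟨ cong (σ *_) ([i*n]/ℕn≡i _ s) ⟩
    σ * (+ choose (suc s) (suc j) + (+ 1 - + k) * + choose s j)
      ≡⟨ split (-1ℤ ^ j) (+ choose (suc s) (suc j)) (+ k) (+ choose s j) ⟩
    σ * + choose (suc s) (suc j) + (+ k - + 1) * (-1ℤ ^ j * + choose s j)
      ≡⟨ cong₂ (λ a b → σ * + choose a (suc j) + (+ k - + 1) * (-1ℤ ^ j * + choose b j))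
               (sym (ℕₚ.m+n∸n≡m (suc s) j)) (sym (ℕₚ.m+n∸n≡m s j)) ⟩
    dicksonD k (suc (s ℕ.+ j)) (suc j) ∎
    where
    open ≡-Reasoning
    σ = -1ℤ ^ suc j
    split : ∀ τ a k b → -1ℤ * τ * (a + (+ 1 - k) * b) ≡ -1ℤ * τ * a + (k - + 1) * (τ * b)
    split = solve-∀

  signed-Dcoeff : ∀ k m i → -1ℤ ^ i * Dcoeff (suc m) k i ≡ dicksonD k m i
  signed-Dcoeff k m zero = begin
    + 1 * Dcoeff (suc m) k 0
      ≡⟨ cong (+ 1 *_) (Dcoeff-unfold (suc m) k 0 m refl) ⟩
    + 1 * (((+ suc m - + k * + 0) * + (suc m C 0)) /ℕ suc m)
      ≡⟨ cong₂ (λ a c → + 1 * (((+ suc m - a) * + c) /ℕ suc m)) (ℤₚ.*-zeroʳ (+ k)) (sym (choose≡C (suc m) 0)) ⟩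
    + 1 * (((+ suc m - + 0) * + 1) /ℕ suc m)
      ≡⟨ cong (λ t → + 1 * (t /ℕ suc m)) (unit (+ suc m)) ⟩
    + 1 * ((+ 1 * + suc m) /ℕ suc m)
      ≡⟨ cong (+ 1 *_) ([i*n]/ℕn≡i (+ 1) m) ⟩
    + 1
      ≡⟨ sym (cong (_+_ (+ 1)) (ℤₚ.*-zeroʳ (+ k - + 1))) ⟩
    dicksonD k m 0 ∎
    where
    open ≡-Reasoning
    unit : ∀ x → (x - + 0) * + 1 ≡ + 1 * x
    unit = solve-∀
  signed-Dcoeff k m (suc j) with m ≤? j
  ... | yes m≤j = begin
    -1ℤ ^ suc j * Dcoeff (suc m) k (suc j) ≡⟨ cong (-1ℤ ^ suc j *_) (Dcoeff-beyond (suc m) k (suc j) (s≤s m≤j)) ⟩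
    -1ℤ ^ suc j * + 0                      ≡⟨ ℤₚ.*-zeroʳ (-1ℤ ^ suc j) ⟩
    + 0                                    ≡⟨ sym (dicksonD-vanishes k m (suc j) m+2≤2[1+j]) ⟩
    dicksonD k m (suc j)                   ∎
    where
    open ≡-Reasoning
    m+2≤2[1+j] : 2 ℕ.+ m ≤ 2 ℕ.* suc j
    m+2≤2[1+j] = subst (2 ℕ.+ m ≤_) (sym (ℕₚ.*-suc 2 j)) (s≤s (s≤s (ℕₚ.≤-trans m≤j (ℕₚ.m≤n*m j 2))))
  ... | no m≰j = signed-Dcoeff-interior k (m ℕ.∸ suc j) j
                   (trans (sym (ℕₚ.m∸n+n≡m (ℕₚ.≰⇒> m≰j))) (ℕₚ.+-suc (m ℕ.∸ suc j) j))

  n<2[1+⌊n/2⌋] : ∀ n → n < 2 ℕ.* suc ⌊ n /2⌋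
  n<2[1+⌊n/2⌋] zero          = s≤s z≤n
  n<2[1+⌊n/2⌋] (suc zero)    = s≤s (s≤s z≤n)
  n<2[1+⌊n/2⌋] (suc (suc n)) = subst (suc (suc n) <_) (sym (ℕₚ.*-suc 2 (suc ⌊ n /2⌋))) (s≤s (s≤s (n<2[1+⌊n/2⌋] n)))

  coeff-DZ : ∀ k m i → coeff (DZ (suc m) k) i ≡ dicksonD k m i
  coeff-DZ k m i = trans (coeff-monomials (suc ⌊ suc m /2⌋) (λ j → -1ℤ ^ j * Dcoeff (suc m) k j) vanish i) (signed-Dcoeff k m i)
    where
    vanish : ∀ j → suc ⌊ suc m /2⌋ ≤ j → -1ℤ ^ j * Dcoeff (suc m) k j ≡ + 0
    vanish j half<j = trans (signed-Dcoeff k m j)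
      (dicksonD-vanishes k m j (ℕₚ.≤-trans (n<2[1+⌊n/2⌋] (suc m)) (ℕₚ.*-monoʳ-≤ 2 half<j)))

  coeff-linear-combination : ∀ a P b Q c S i →
    coeff (scale a P +ᴾ scale b Q +ᴾ scale c S) i ≡ a * coeff P i + b * coeff Q i + c * coeff S i
  coeff-linear-combination a P b Q c S i = begin
    coeff (scale a P +ᴾ scale b Q +ᴾ scale c S) i
      ≡⟨ coeff-+ᴾ (scale a P +ᴾ scale b Q) (scale c S) i ⟩
    coeff (scale a P +ᴾ scale b Q) i + coeff (scale c S) i
      ≡⟨ cong (_+ coeff (scale c S) i) (coeff-+ᴾ (scale a P) (scale b Q) i) ⟩
    coeff (scale a P) i + coeff (scale b Q) i + coeff (scale c S) i
      ≡⟨ cong₂ _+_ (cong₂ _+_ (coeff-scale a P i) (coeff-scale b Q i)) (coeff-scale c S i) ⟩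
    a * coeff P i + b * coeff Q i + c * coeff S i ∎
    where open ≡-Reasoning

  -- Substituting 1 + g x into P_{m+2} = a P_{m+1} + (b + c x) P_m gives
  -- F_{m+2} = a F_{m+1} + (b + c (1 + g x)) F_m.
  compose-recurrence : ∀ (P : ℕ → List ℤ) g {a b c} → Recurrence a b c (λ m → coeff (P m)) →
    Recurrence a (b + c) (c * g) (λ m → coeff (compose (P m) (+ 1 ∷ g ∷ [])))
  compose-recurrence P g {a} {b} {c} rP .recur m i = begin
    coeff (F (2 ℕ.+ m)) i
      ≡⟨ ≈ᴾ F-step i ⟩
    coeff (scale a (F (1 ℕ.+ m)) +ᴾ scale b (F m) +ᴾ scale c (G *ᴾ F m)) i
      ≡⟨ coeff-linear-combination a (F (1 ℕ.+ m)) b (F m) c (G *ᴾ F m) i ⟩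
    a * coeff (F (1 ℕ.+ m)) i + b * coeff (F m) i + c * coeff (G *ᴾ F m) i
      ≡⟨ cong (λ t → a * coeff (F (1 ℕ.+ m)) i + b * coeff (F m) i + c * t) coeff-G*F ⟩
    a * coeff (F (1 ℕ.+ m)) i + b * coeff (F m) i + c * (coeff (F m) i + g * shift (coeff (F m)) i)
      ≡⟨ regroup a b c g _ _ _ ⟩
    a * coeff (F (1 ℕ.+ m)) i + (b + c) * coeff (F m) i + c * g * shift (coeff (F m)) i ∎
    where
    open ≡-Reasoning
    G = + 1 ∷ g ∷ []
    F : ℕ → List ℤ
    F m = compose (P m) G
    P-step : P (2 ℕ.+ m) ≃ scale a (P (1 ℕ.+ m)) +ᴾ scale b (P m) +ᴾ scale c (+ 0 ∷ P m)
    P-step = coeffwise λ i → trans (recur rP m i) (sym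
      (trans (coeff-linear-combination a (P (1 ℕ.+ m)) b (P m) c (+ 0 ∷ P m) i)
             (cong (λ t → a * coeff (P (1 ℕ.+ m)) i + b * coeff (P m) i + c * t) (coeff-0∷ (P m) i))))
    F-step : F (2 ℕ.+ m) ≃ scale a (F (1 ℕ.+ m)) +ᴾ scale b (F m) +ᴾ scale c (G *ᴾ F m)
    F-step = ≃-trans (compose-congʳ G P-step) (compose-step a (P (1 ℕ.+ m)) b (P m) c G)
    coeff-G*F : coeff (G *ᴾ F m) i ≡ coeff (F m) i + g * shift (coeff (F m)) i
    coeff-G*F = begin
      coeff (G *ᴾ F m) i                              ≡⟨ ≈ᴾ (linear-*ᴾ (+ 1) g (F m)) i ⟩
      coeff (scale (+ 1) (F m) +ᴾ scale g (+ 0 ∷ F m)) i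
                                                      ≡⟨ coeff-+ᴾ (scale (+ 1) (F m)) (scale g (+ 0 ∷ F m)) i ⟩
      coeff (scale (+ 1) (F m)) i + coeff (scale g (+ 0 ∷ F m)) i
                                                      ≡⟨ cong₂ _+_ (trans (coeff-scale (+ 1) (F m) i) (ℤₚ.*-identityˡ _))
                                                                   (trans (coeff-scale g (+ 0 ∷ F m) i)
                                                                          (cong (g *_) (coeff-0∷ (F m) i))) ⟩
      coeff (F m) i + g * shift (coeff (F m)) i       ∎
    regroup : ∀ a b c g x₁ x₀ s → a * x₁ + b * x₀ + c * (x₀ + g * s) ≡ a * x₁ + (b + c) * x₀ + c * g * s
    regroup = solve-∀

  fCoefficient-vanishes : ∀ k m i → 2 ℕ.+ m ≤ 2 ℕ.* i → fCoefficient k m i ≡ + 0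
  fCoefficient-vanishes k m (suc i) m+2≤2i = begin
    + k * (oddBinomials m (suc i) - oddBinomials m i) + + 2 * evenBinomials (suc m) (suc i)
      ≡⟨ cong₂ (λ s t → + k * (+ s - + t) + + 2 * + choose (suc m) (2 ℕ.* suc i))
               (n<k⇒choose≡0 (ℕₚ.<-trans (s≤s (ℕₚ.n≤1+n m)) (s≤s m+2≤2i)))
               (n<k⇒choose≡0 (s≤s m≤2i)) ⟩
    + k * (+ 0 - + 0) + + 2 * + choose (suc m) (2 ℕ.* suc i)
      ≡⟨ cong (λ t → + k * + 0 + + 2 * + t) (n<k⇒choose≡0 m+2≤2i) ⟩
    + k * + 0 + + 2 * + 0
      ≡⟨ cong (_+ + 0) (ℤₚ.*-zeroʳ (+ k)) ⟩
    + 0 ∎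
    where
    open ≡-Reasoning
    m≤2i : m ≤ 2 ℕ.* i
    m≤2i = ℕₚ.+-cancelˡ-≤ 2 m (2 ℕ.* i) (subst (2 ℕ.+ m ≤_) (ℕₚ.*-suc 2 i) m+2≤2i)

  fCoefficient-one : ∀ k i → fCoefficient k 0 i ≡ coeff (+ 2 ∷ []) i
  fCoefficient-one k zero    = cong (_+ + 2) (ℤₚ.*-zeroʳ (+ k))
  fCoefficient-one k (suc i) = fCoefficient-vanishes k 0 (suc i) (subst (2 ≤_) (sym (ℕₚ.*-suc 2 i)) (s≤s (s≤s z≤n)))

  fCoefficient-two : ∀ k i → fCoefficient k 1 i ≡ coeff (+ k + + 2 ∷ + 2 - + k ∷ []) i
  fCoefficient-two k zero          = cong (_+ + 2) (ℤₚ.*-identityʳ (+ k))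
  fCoefficient-two k (suc zero)    = sub (+ k)
    where
    sub : ∀ k → k * -1ℤ + + 2 ≡ + 2 - k
    sub = solve-∀
  fCoefficient-two k (suc (suc i)) =
    fCoefficient-vanishes k 1 (2 ℕ.+ i) (subst (3 ≤_) (sym (ℕₚ.*-suc 2 (suc i))) (s≤s (s≤s (s≤s z≤n))))

  dicksonD-one : ∀ k i → dicksonD k 0 i ≡ coeff (+ 1 ∷ []) i
  dicksonD-one k zero    = cong (_+_ (+ 1)) (ℤₚ.*-zeroʳ (+ k - + 1))
  dicksonD-one k (suc i) = dicksonD-vanishes k 0 (suc i) (subst (2 ≤_) (sym (ℕₚ.*-suc 2 i)) (s≤s (s≤s z≤n)))

  dicksonD-two : ∀ k i → dicksonD k 1 i ≡ coeff (+ 1 ∷ + k - + 2 ∷ []) i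
  dicksonD-two k zero          = cong (_+_ (+ 1)) (ℤₚ.*-zeroʳ (+ k - + 1))
  dicksonD-two k (suc zero)    = sub (+ k)
    where
    sub : ∀ k → -1ℤ + (k - + 1) * + 1 ≡ k - + 2
    sub = solve-∀
  dicksonD-two k (suc (suc i)) =
    dicksonD-vanishes k 1 (2 ℕ.+ i) (subst (3 ≤_) (sym (ℕₚ.*-suc 2 (suc i))) (s≤s (s≤s (s≤s z≤n))))

  1-4x : List ℤ
  1-4x = + 1 ∷ -[1+ 3 ] ∷ []

  f∘[1-4x]-recurrence : ∀ k → Recurrence (+ 2) (+ 0) -[1+ 3 ] (λ m → coeff (compose (fZ (suc m) k) 1-4x))
  f∘[1-4x]-recurrence k =
    compose-recurrence (λ m → fZ (suc m) k) -[1+ 3 ] (recurrence-cong (λ m i → sym (coeff-fZ k m i)) (fCoefficient-recurrence k))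

  scaled-dicksonD-recurrence : ∀ k → Recurrence (+ 2) (+ 0) -[1+ 3 ] (λ m i → (+ 2) ^ m * (+ 2 * dicksonD k m i))
  scaled-dicksonD-recurrence k = recurrence-geometric (+ 2) (recurrence-scale (+ 2) (dicksonD-recurrence k))

  f∘[1-4x]≡2ⁿD : ∀ k m i → coeff (compose (fZ (suc m) k) 1-4x) i ≡ (+ 2) ^ m * (+ 2 * dicksonD k m i)
  f∘[1-4x]≡2ⁿD k = recurrence-unique (f∘[1-4x]-recurrence k) (scaled-dicksonD-recurrence k) base₁ base₂
    where
    f₁ : fZ 1 k ≃ + 2 ∷ []
    f₁ = coeffwise λ i → trans (coeff-fZ k 0 i) (fCoefficient-one k i)
    f₂ : fZ 2 k ≃ + k + + 2 ∷ + 2 - + k ∷ []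
    f₂ = coeffwise λ i → trans (coeff-fZ k 1 i) (fCoefficient-two k i)
    base₁ : ∀ i → coeff (compose (fZ 1 k) 1-4x) i ≡ + 1 * (+ 2 * dicksonD k 0 i)
    base₁ i = trans (≈ᴾ (compose-congʳ 1-4x f₁) i)
                    (trans (by-cases i) (cong (λ d → + 1 * (+ 2 * d)) (sym (dicksonD-one k i))))
      where
      by-cases : ∀ i → coeff (compose (+ 2 ∷ []) 1-4x) i ≡ + 1 * (+ 2 * coeff (+ 1 ∷ []) i)
      by-cases zero          = refl
      by-cases (suc zero)    = refl
      by-cases (suc (suc i)) = refl
    base₂ : ∀ i → coeff (compose (fZ 2 k) 1-4x) i ≡ + 2 * (+ 2 * dicksonD k 1 i)
    base₂ i = trans (≈ᴾ (compose-congʳ 1-4x f₂) i)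
                    (trans (by-cases i) (cong (λ d → + 2 * (+ 2 * d)) (sym (dicksonD-two k i))))
      where
      constant : ∀ k → k + + 2 + (+ 1 * (+ 2 - k + + 0) + + 0) ≡ + 2 * (+ 2 * + 1)
      constant = solve-∀
      linear : ∀ k → + 0 + (-[1+ 3 ] * (+ 2 - k + + 0) + + 0) ≡ + 2 * (+ 2 * (k - + 2))
      linear = solve-∀
      by-cases : ∀ i → coeff (compose (+ k + + 2 ∷ + 2 - + k ∷ []) 1-4x) i ≡ + 2 * (+ 2 * coeff (+ 1 ∷ + k - + 2 ∷ []) i)
      by-cases zero                      = constant (+ k)
      by-cases (suc zero)                = linear (+ k)
      by-cases (suc (suc zero))          = refl
      by-cases (suc (suc (suc zero)))    = refl
      by-cases (suc (suc (suc (suc i)))) = refl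

  2ⁿD≃f∘[1-4x] : ∀ k n → scale ((+ 2) ^ suc n) (DZ (suc n) k) ≃ compose (fZ (suc n) k) 1-4x
  2ⁿD≃f∘[1-4x] k n = coeffwise λ i → begin
    coeff (scale ((+ 2) ^ suc n) (DZ (suc n) k)) i   ≡⟨ coeff-scale ((+ 2) ^ suc n) (DZ (suc n) k) i ⟩
    (+ 2) ^ suc n * coeff (DZ (suc n) k) i           ≡⟨ cong (λ d → (+ 2) ^ suc n * d) (coeff-DZ k n i) ⟩
    + 2 * (+ 2) ^ n * dicksonD k n i                 ≡⟨ reassociate (+ 2) ((+ 2) ^ n) (dicksonD k n i) ⟩
    (+ 2) ^ n * (+ 2 * dicksonD k n i)               ≡⟨ sym (f∘[1-4x]≡2ⁿD k n i) ⟩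
    coeff (compose (fZ (suc n) k) 1-4x) i            ∎
    where
    open ≡-Reasoning
    reassociate : ∀ a b d → a * b * d ≡ b * (a * d)
    reassociate = solve-∀

module Reduction {c ℓ} (R : CommutativeRing c ℓ) where
  open CommutativeRing R
  open OverRing R
  open PR
  open PolynomialAlgebra R
  open import Data.Nat as ℕ using ()
  import Data.Nat.Properties as ℕₚ
  open import Data.Integer as ℤ using (+_; _⊖_)
  import Data.Integer.Properties as ℤₚ
  open import Data.List.Relation.Binary.Pointwise using (_∷_; [])
  import Relation.Binary.PropositionalEquality as ≡
  import Relation.Binary.Reasoning.Setoid
  module ≈-Reasoning = Relation.Binary.Reasoning.Setoid setoid
  open import Algebra.Properties.Ring ring using (-0#≈0#; -‿involutive; -‿+-comm; -‿distribˡ-*; -‿distribʳ-*)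
  open import Algebra.Properties.CommutativeSemigroup +-commutativeSemigroup using (interchange)
  open import Algebra.Properties.CommutativeSemigroup *-commutativeSemigroup using () renaming (interchange to interchange-*)
  module ℤ[x] = PolynomialAlgebra ℤₚ.+-*-commutativeRing

  ιℕ-+ : ∀ m n → ιℕ (m ℕ.+ n) ≈ ιℕ m + ιℕ n
  ιℕ-+ zero    n = sym (+-identityˡ (ιℕ n))
  ιℕ-+ (suc m) n = trans (+-congˡ (ιℕ-+ m n)) (sym (+-assoc 1# (ιℕ m) (ιℕ n)))

  ιℕ-* : ∀ m n → ιℕ (m ℕ.* n) ≈ ιℕ m * ιℕ n
  ιℕ-* zero    n = sym (zeroˡ (ιℕ n))
  ιℕ-* (suc m) n = begin
    ιℕ (n ℕ.+ m ℕ.* n)         ≈⟨ ιℕ-+ n (m ℕ.* n) ⟩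
    ιℕ n + ιℕ (m ℕ.* n)        ≈⟨ +-cong (sym (*-identityˡ (ιℕ n))) (ιℕ-* m n) ⟩
    1# * ιℕ n + ιℕ m * ιℕ n    ≈⟨ distribʳ (ιℕ n) 1# (ιℕ m) ⟨
    (1# + ιℕ m) * ιℕ n         ∎
    where open ≈-Reasoning

  ι-neg : ∀ i → ι (ℤ.- i) ≈ - ι i
  ι-neg (+ zero)  = sym -0#≈0#
  ι-neg (+ suc n) = refl
  ι-neg -[1+ n ]  = sym (-‿involutive _)

  ι-⊖ : ∀ m n → ι (m ⊖ n) ≈ ιℕ m - ιℕ n
  ι-⊖ m       zero    = begin
    ι (m ⊖ 0)     ≈⟨ reflexive (≡.cong ι (ℤₚ.⊖-≥ {m} {0} z≤n)) ⟩
    ιℕ m          ≈⟨ +-identityʳ (ιℕ m) ⟨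
    ιℕ m + 0#     ≈⟨ +-congˡ -0#≈0# ⟨
    ιℕ m - 0#     ∎
    where open ≈-Reasoning
  ι-⊖ zero    (suc n) = sym (+-identityˡ _)
  ι-⊖ (suc m) (suc n) = begin
    ι (suc m ⊖ suc n)              ≈⟨ reflexive (≡.cong ι (ℤₚ.[1+m]⊖[1+n]≡m⊖n m n)) ⟩
    ι (m ⊖ n)                      ≈⟨ ι-⊖ m n ⟩
    ιℕ m - ιℕ n                    ≈⟨ +-identityˡ _ ⟨
    0# + (ιℕ m - ιℕ n)             ≈⟨ +-congʳ (-‿inverseʳ 1#) ⟨
    (1# - 1#) + (ιℕ m - ιℕ n)      ≈⟨ interchange 1# (- 1#) (ιℕ m) (- ιℕ n) ⟩
    (1# + ιℕ m) + (- 1# - ιℕ n)    ≈⟨ +-congˡ (-‿+-comm 1# (ιℕ n)) ⟩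
    (1# + ιℕ m) - (1# + ιℕ n)      ∎
    where open ≈-Reasoning

  ι-+ : ∀ i j → ι (i ℤ.+ j) ≈ ι i + ι j
  ι-+ (+ m)    (+ n)    = ιℕ-+ m n
  ι-+ (+ m)    -[1+ n ] = ι-⊖ m (suc n)
  ι-+ -[1+ m ] (+ n)    = trans (ι-⊖ n (suc m)) (+-comm _ _)
  ι-+ -[1+ m ] -[1+ n ] = begin
    - ιℕ (suc (suc (m ℕ.+ n)))         ≈⟨ -‿cong (reflexive (≡.cong (λ t → ιℕ (suc t)) (≡.sym (ℕₚ.+-suc m n)))) ⟩
    - ιℕ (suc m ℕ.+ suc n)             ≈⟨ -‿cong (ιℕ-+ (suc m) (suc n)) ⟩
    - (ιℕ (suc m) + ιℕ (suc n))        ≈⟨ -‿+-comm _ _ ⟨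
    - ιℕ (suc m) - ιℕ (suc n)          ∎
    where open ≈-Reasoning

  ι-pos-* : ∀ m j → ι (+ m ℤ.* j) ≈ ιℕ m * ι j
  ι-pos-* m (+ n)    = trans (reflexive (≡.cong ι (≡.sym (ℤₚ.pos-* m n)))) (ιℕ-* m n)
  ι-pos-* m -[1+ n ] = begin
    ι (+ m ℤ.* -[1+ n ])          ≈⟨ reflexive (≡.cong ι (≡.sym (ℤₚ.neg-distribʳ-* (+ m) (+ suc n)))) ⟩
    ι (ℤ.- (+ m ℤ.* + suc n))     ≈⟨ ι-neg (+ m ℤ.* + suc n) ⟩
    - ι (+ m ℤ.* + suc n)         ≈⟨ -‿cong (ι-pos-* m (+ suc n)) ⟩
    - (ιℕ m * ιℕ (suc n))         ≈⟨ -‿distribʳ-* (ιℕ m) (ιℕ (suc n)) ⟩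
    ιℕ m * - ιℕ (suc n)           ∎
    where open ≈-Reasoning

  ι-* : ∀ i j → ι (i ℤ.* j) ≈ ι i * ι j
  ι-* (+ m)    j = ι-pos-* m j
  ι-* -[1+ m ] j = begin
    ι (-[1+ m ] ℤ.* j)            ≈⟨ reflexive (≡.cong ι (≡.sym (ℤₚ.neg-distribˡ-* (+ suc m) j))) ⟩
    ι (ℤ.- (+ suc m ℤ.* j))       ≈⟨ ι-neg (+ suc m ℤ.* j) ⟩
    - ι (+ suc m ℤ.* j)           ≈⟨ -‿cong (ι-pos-* (suc m) j) ⟩
    - (ιℕ (suc m) * ι j)          ≈⟨ -‿distribˡ-* (ιℕ (suc m)) (ι j) ⟩
    - ιℕ (suc m) * ι j            ∎
    where open ≈-Reasoning

  ι-^ : ∀ i n → ι (i ℤ.^ n) ≈ pow (ι i) n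
  ι-^ i zero    = +-identityʳ 1#
  ι-^ i (suc n) = trans (ι-* i (i ℤ.^ n)) (*-congˡ (ι-^ i n))

  pow-inverse : ∀ {a b} n → a * b ≈ 1# → pow a n * pow b n ≈ 1#
  pow-inverse zero    ab≈1 = *-identityˡ 1#
  pow-inverse {a} {b} (suc n) ab≈1 = begin
    (a * pow a n) * (b * pow b n)   ≈⟨ interchange-* a (pow a n) b (pow b n) ⟩
    (a * b) * (pow a n * pow b n)   ≈⟨ *-cong ab≈1 (pow-inverse n ab≈1) ⟩
    1# * 1#                         ≈⟨ *-identityˡ 1# ⟩
    1#                              ∎
    where open ≈-Reasoning

  coeff-reduce : ∀ P i → coeff (reduce P) i ≈ ι (PZ.coeff P i)
  coeff-reduce []      i       = refl
  coeff-reduce (p ∷ P) zero    = refl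
  coeff-reduce (p ∷ P) (suc i) = coeff-reduce P i

  reduce-cong : ∀ {P Q} → P ℤ[x].≃ Q → reduce P ≃ reduce Q
  reduce-cong {P} {Q} (ℤ[x].coeffwise P≡Q) = coeffwise λ i →
    trans (coeff-reduce P i) (trans (reflexive (≡.cong ι (P≡Q i))) (sym (coeff-reduce Q i)))

  reduce-+ᴾ : ∀ P Q → reduce (P PZ.+ᴾ Q) ≃ reduce P +ᴾ reduce Q
  reduce-+ᴾ P Q = coeffwise λ i → begin
    coeff (reduce (P PZ.+ᴾ Q)) i                ≈⟨ coeff-reduce (P PZ.+ᴾ Q) i ⟩
    ι (PZ.coeff (P PZ.+ᴾ Q) i)                  ≈⟨ reflexive (≡.cong ι (ℤ[x].coeff-+ᴾ P Q i)) ⟩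
    ι (PZ.coeff P i ℤ.+ PZ.coeff Q i)           ≈⟨ ι-+ (PZ.coeff P i) (PZ.coeff Q i) ⟩
    ι (PZ.coeff P i) + ι (PZ.coeff Q i)         ≈⟨ +-cong (coeff-reduce P i) (coeff-reduce Q i) ⟨
    coeff (reduce P) i + coeff (reduce Q) i     ≈⟨ coeff-+ᴾ (reduce P) (reduce Q) i ⟨
    coeff (reduce P +ᴾ reduce Q) i              ∎
    where open ≈-Reasoning

  reduce-scale : ∀ a P → reduce (PZ.scale a P) ≃ scale (ι a) (reduce P)
  reduce-scale a P = coeffwise λ i → begin
    coeff (reduce (PZ.scale a P)) i      ≈⟨ coeff-reduce (PZ.scale a P) i ⟩
    ι (PZ.coeff (PZ.scale a P) i)        ≈⟨ reflexive (≡.cong ι (ℤ[x].coeff-scale a P i)) ⟩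
    ι (a ℤ.* PZ.coeff P i)               ≈⟨ ι-* a (PZ.coeff P i) ⟩
    ι a * ι (PZ.coeff P i)               ≈⟨ *-congˡ (coeff-reduce P i) ⟨
    ι a * coeff (reduce P) i             ≈⟨ coeff-scale (ι a) (reduce P) i ⟨
    coeff (scale (ι a) (reduce P)) i     ∎
    where open ≈-Reasoning

  reduce-*ᴾ : ∀ P Q → reduce (P PZ.*ᴾ Q) ≃ reduce P *ᴾ reduce Q
  reduce-*ᴾ []      Q = ≃-refl
  reduce-*ᴾ (p ∷ P) Q =
    ≃-trans (reduce-+ᴾ (PZ.scale p Q) (+ 0 ∷ P PZ.*ᴾ Q))
            (+ᴾ-cong (reduce-scale p Q) (∷-cong refl (reduce-*ᴾ P Q)))

  reduce-compose : ∀ P G → reduce (PZ.compose P G) ≃ compose (reduce P) (reduce G)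
  reduce-compose []      G = ≃-refl
  reduce-compose (p ∷ P) G =
    ≃-trans (reduce-+ᴾ (p ∷ []) (G PZ.*ᴾ PZ.compose P G))
            (+ᴾ-congˡ (ι p ∷ []) (≃-trans (reduce-*ᴾ G (PZ.compose P G)) (*ᴾ-congˡ (reduce G) (reduce-compose P G))))

  ι2≈1+1 : ι (+ 2) ≈ 1# + 1#
  ι2≈1+1 = +-congˡ (+-identityʳ 1#)

  ι[-4]-inverse : ∀ {h} → h * (1# + 1#) ≈ 1# → ι -[1+ 3 ] * - (h * h) ≈ 1#
  ι[-4]-inverse {h} h2≈1 = begin
    - ιℕ 4 * - (h * h)                       ≈⟨ -‿distribˡ-* (ιℕ 4) (- (h * h)) ⟨
    - (ιℕ 4 * - (h * h))                     ≈⟨ -‿cong (-‿distribʳ-* (ιℕ 4) (h * h)) ⟨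
    - - (ιℕ 4 * (h * h))                     ≈⟨ -‿involutive (ιℕ 4 * (h * h)) ⟩
    ιℕ 4 * (h * h)                           ≈⟨ *-congʳ (trans (ιℕ-* 2 2) (*-cong ι2≈1+1 ι2≈1+1)) ⟩
    (1# + 1#) * (1# + 1#) * (h * h)          ≈⟨ interchange-* (1# + 1#) (1# + 1#) h h ⟩
    (1# + 1#) * h * ((1# + 1#) * h)          ≈⟨ *-cong 2h≈1 2h≈1 ⟩
    1# * 1#                                  ≈⟨ *-identityˡ 1# ⟩
    1#                                       ∎
    where
    open ≈-Reasoning
    2h≈1 : (1# + 1#) * h ≈ 1#
    2h≈1 = trans (*-comm (1# + 1#) h) h2≈1

  open IntegerIdentity using (1-4x; 2ⁿD≃f∘[1-4x])

  D≃f∘[1-4x] : ∀ h → h * (1# + 1#) ≈ 1# → ∀ k n →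
    reduce (DZ (suc n) k) ≃ scale (pow h (suc n)) (compose (reduce (fZ (suc n) k)) (1# ∷ ι -[1+ 3 ] ∷ []))
  D≃f∘[1-4x] h h2≈1 k n = begin
    D
      ≈⟨ scale-identity D ⟨
    scale 1# D
      ≈⟨ scale-cong (sym (pow-inverse (suc n) (trans (*-congˡ ι2≈1+1) h2≈1))) ≃-refl ⟩
    scale (pow h (suc n) * pow (ι (+ 2)) (suc n)) D
      ≈⟨ scale-* (pow h (suc n)) (pow (ι (+ 2)) (suc n)) D ⟩
    scale (pow h (suc n)) (scale (pow (ι (+ 2)) (suc n)) D)
      ≈⟨ scale-cong refl (scale-cong (sym (ι-^ (+ 2) (suc n))) ≃-refl) ⟩
    scale (pow h (suc n)) (scale (ι ((+ 2) ℤ.^ suc n)) D)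
      ≈⟨ scale-cong refl (reduce-scale ((+ 2) ℤ.^ suc n) (DZ (suc n) k)) ⟨
    scale (pow h (suc n)) (reduce (PZ.scale ((+ 2) ℤ.^ suc n) (DZ (suc n) k)))
      ≈⟨ scale-cong refl (reduce-cong (2ⁿD≃f∘[1-4x] k n)) ⟩
    scale (pow h (suc n)) (reduce (PZ.compose (fZ (suc n) k) 1-4x))
      ≈⟨ scale-cong refl (reduce-compose (fZ (suc n) k) 1-4x) ⟩
    scale (pow h (suc n)) (compose (reduce (fZ (suc n) k)) (ι (+ 1) ∷ ι -[1+ 3 ] ∷ []))
      ≈⟨ scale-cong refl (compose-congˡ (reduce (fZ (suc n) k)) (+-identityʳ 1# ∷ refl ∷ [])) ⟩
    scale (pow h (suc n)) (compose (reduce (fZ (suc n) k)) (1# ∷ ι -[1+ 3 ] ∷ [])) ∎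
    where
    open ≃-Reasoning
    D = reduce (DZ (suc n) k)

module PermutationPolynomials {c ℓ} (R : CommutativeRing c ℓ) where
  open CommutativeRing R
  open OverRing R
  open PR
  open PolynomialAlgebra R
  open import Level using (_⊔_)
  open import Function.Base using (_∘_)
  open import Function.Bundles using (mk⇔)
  open import Function.Properties.Equivalence using (⇔-setoid)
  open import Algebra.Properties.CommutativeSemigroup +-commutativeSemigroup using (interchange)
  open import Algebra.Properties.CommutativeSemigroup *-commutativeSemigroup using () renaming (x∙yz≈y∙xz to x*yz≈y*xz)
  open import Algebra.Properties.AbelianGroup +-abelianGroup using (xyx⁻¹≈y)
  import Relation.Binary.Reasoning.Setoid
  module ≈-Reasoning = Relation.Binary.Reasoning.Setoid setoid
  module ⇔-Reasoning = Relation.Binary.Reasoning.Setoid (⇔-setoid (c ⊔ ℓ))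

  Permutes : (Carrier → Carrier) → Set (c ⊔ ℓ)
  Permutes f = (∀ x y → f x ≈ f y → x ≈ y) × (∀ y → ∃ λ x → f x ≈ y)

  private variable
    f g : Carrier → Carrier

  permutes-cong : (∀ x → f x ≈ g x) → Permutes f ⇔ Permutes g
  permutes-cong f≈g = mk⇔ (transfer f≈g) (transfer (λ x → sym (f≈g x)))
    where
    transfer : ∀ {f g} → (∀ x → f x ≈ g x) → Permutes f → Permutes g
    transfer f≈g (inj , surj) =
      (λ x y gx≈gy → inj x y (trans (f≈g x) (trans gx≈gy (sym (f≈g y))))) ,
      (λ y → let x , fx≈y = surj y in x , trans (sym (f≈g x)) fx≈y)

  permutes-scale : ∀ {u u⁻¹} → u⁻¹ * u ≈ 1# → Permutes f ⇔ Permutes (λ x → u * f x)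
  permutes-scale {f} {u} {u⁻¹} u⁻¹u≈1 = mk⇔
    (λ (inj , surj) →
      (λ x y ufx≈ufy → inj x y (cancel ufx≈ufy)) ,
      (λ y → let x , fx≈u⁻¹y = surj (u⁻¹ * y) in x , trans (*-congˡ fx≈u⁻¹y) (uncancel y)))
    (λ (inj , surj) →
      (λ x y fx≈fy → inj x y (*-congˡ fx≈fy)) ,
      (λ y → let x , ufx≈uy = surj (u * y) in x , cancel ufx≈uy))
    where
    open ≈-Reasoning
    cancel : ∀ {a b} → u * a ≈ u * b → a ≈ b
    cancel {a} {b} ua≈ub = begin
      a               ≈⟨ *-identityˡ a ⟨
      1# * a          ≈⟨ *-congʳ u⁻¹u≈1 ⟨
      (u⁻¹ * u) * a   ≈⟨ *-assoc u⁻¹ u a ⟩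
      u⁻¹ * (u * a)   ≈⟨ *-congˡ ua≈ub ⟩
      u⁻¹ * (u * b)   ≈⟨ *-assoc u⁻¹ u b ⟨
      (u⁻¹ * u) * b   ≈⟨ *-congʳ u⁻¹u≈1 ⟩
      1# * b          ≈⟨ *-identityˡ b ⟩
      b               ∎
    uncancel : ∀ a → u * (u⁻¹ * a) ≈ a
    uncancel a = begin
      u * (u⁻¹ * a)   ≈⟨ x*yz≈y*xz u u⁻¹ a ⟩
      u⁻¹ * (u * a)   ≈⟨ *-assoc u⁻¹ u a ⟨
      (u⁻¹ * u) * a   ≈⟨ *-congʳ u⁻¹u≈1 ⟩
      1# * a          ≈⟨ *-identityˡ a ⟩
      a               ∎

  permutes-∘ : ∀ {φ ψ : Carrier → Carrier} →
    (∀ {x y} → x ≈ y → f x ≈ f y) → (∀ {x y} → x ≈ y → φ x ≈ φ y) → (∀ {x y} → x ≈ y → ψ x ≈ ψ y) →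
    (∀ y → φ (ψ y) ≈ y) → (∀ x → ψ (φ x) ≈ x) → Permutes f ⇔ Permutes (f ∘ φ)
  permutes-∘ {f} {φ} {ψ} f-cong φ-cong ψ-cong φψ≈id ψφ≈id = mk⇔
    (λ (inj , surj) →
      (λ x y fφx≈fφy → trans (sym (ψφ≈id x)) (trans (ψ-cong (inj (φ x) (φ y) fφx≈fφy)) (ψφ≈id y))) ,
      (λ y → let x , fx≈y = surj y in ψ x , trans (f-cong (φψ≈id x)) fx≈y))
    (λ (inj , surj) →
      (λ x y fx≈fy → trans (sym (φψ≈id x))
                           (trans (φ-cong (inj (ψ x) (ψ y) (trans (f-cong (φψ≈id x)) (trans fx≈fy (sym (f-cong (φψ≈id y)))))))
                                  (φψ≈id y))) ,
      (λ y → let x , fφx≈y = surj y in φ x , fφx≈y))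

  eval-congʳ : ∀ P {x y} → x ≈ y → eval P x ≈ eval P y
  eval-congʳ []      x≈y = refl
  eval-congʳ (p ∷ P) x≈y = +-congˡ (*-cong x≈y (eval-congʳ P x≈y))

  eval-zero : ∀ {P} x → P ≃ [] → eval P x ≈ 0#
  eval-zero {[]}    x P≃0 = refl
  eval-zero {p ∷ P} x P≃0 = begin
    p + x * eval P x   ≈⟨ +-cong (≈ᴾ P≃0 0) (*-congˡ (eval-zero x (≃-tail-zero P≃0))) ⟩
    0# + x * 0#        ≈⟨ +-identityˡ (x * 0#) ⟩
    x * 0#             ≈⟨ zeroʳ x ⟩
    0#                 ∎
    where open ≈-Reasoning

  eval-cong : ∀ {P Q} x → P ≃ Q → eval P x ≈ eval Q x
  eval-cong {[]}    {Q}     x P≃Q = sym (eval-zero x (≃-sym P≃Q))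
  eval-cong {p ∷ P} {[]}    x P≃Q = eval-zero x P≃Q
  eval-cong {p ∷ P} {q ∷ Q} x P≃Q = +-cong (≃-head P≃Q) (*-congˡ (eval-cong x (≃-tail P≃Q)))

  eval-+ᴾ : ∀ P Q x → eval (P +ᴾ Q) x ≈ eval P x + eval Q x
  eval-+ᴾ []      Q       x = sym (+-identityˡ (eval Q x))
  eval-+ᴾ (p ∷ P) []      x = sym (+-identityʳ (eval (p ∷ P) x))
  eval-+ᴾ (p ∷ P) (q ∷ Q) x = begin
    (p + q) + x * eval (P +ᴾ Q) x            ≈⟨ +-congˡ (*-congˡ (eval-+ᴾ P Q x)) ⟩
    (p + q) + x * (eval P x + eval Q x)      ≈⟨ +-congˡ (distribˡ x (eval P x) (eval Q x)) ⟩
    (p + q) + (x * eval P x + x * eval Q x)  ≈⟨ interchange p q (x * eval P x) (x * eval Q x) ⟩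
    (p + x * eval P x) + (q + x * eval Q x)  ∎
    where open ≈-Reasoning

  eval-scale : ∀ a P x → eval (scale a P) x ≈ a * eval P x
  eval-scale a []      x = sym (zeroʳ a)
  eval-scale a (p ∷ P) x = begin
    a * p + x * eval (scale a P) x   ≈⟨ +-congˡ (*-congˡ (eval-scale a P x)) ⟩
    a * p + x * (a * eval P x)       ≈⟨ +-congˡ (x*yz≈y*xz x a (eval P x)) ⟩
    a * p + a * (x * eval P x)       ≈⟨ distribˡ a p (x * eval P x) ⟨
    a * (p + x * eval P x)           ∎
    where open ≈-Reasoning

  eval-*ᴾ : ∀ P Q x → eval (P *ᴾ Q) x ≈ eval P x * eval Q x
  eval-*ᴾ []      Q x = sym (zeroˡ (eval Q x))
  eval-*ᴾ (p ∷ P) Q x = begin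
    eval (scale p Q +ᴾ (0# ∷ P *ᴾ Q)) x              ≈⟨ eval-+ᴾ (scale p Q) (0# ∷ P *ᴾ Q) x ⟩
    eval (scale p Q) x + (0# + x * eval (P *ᴾ Q) x)  ≈⟨ +-cong (eval-scale p Q x) (+-identityˡ _) ⟩
    p * eval Q x + x * eval (P *ᴾ Q) x               ≈⟨ +-congˡ (*-congˡ (eval-*ᴾ P Q x)) ⟩
    p * eval Q x + x * (eval P x * eval Q x)         ≈⟨ +-congˡ (*-assoc x (eval P x) (eval Q x)) ⟨
    p * eval Q x + (x * eval P x) * eval Q x         ≈⟨ distribʳ (eval Q x) p (x * eval P x) ⟨
    (p + x * eval P x) * eval Q x                    ∎
    where open ≈-Reasoning

  eval-compose : ∀ P G x → eval (compose P G) x ≈ eval P (eval G x)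
  eval-compose []      G x = refl
  eval-compose (p ∷ P) G x = begin
    eval ((p ∷ []) +ᴾ G *ᴾ compose P G) x                 ≈⟨ eval-+ᴾ (p ∷ []) (G *ᴾ compose P G) x ⟩
    (p + x * 0#) + eval (G *ᴾ compose P G) x              ≈⟨ +-cong (trans (+-congˡ (zeroʳ x)) (+-identityʳ p))
                                                                    (eval-*ᴾ G (compose P G) x) ⟩
    p + eval G x * eval (compose P G) x                   ≈⟨ +-congˡ (*-congˡ (eval-compose P G x)) ⟩
    p + eval G x * eval P (eval G x)                      ∎
    where open ≈-Reasoning

  eval-linear : ∀ a b x → eval (a ∷ b ∷ []) x ≈ a + x * b
  eval-linear a b x = +-congˡ (*-congˡ (trans (+-congˡ (zeroʳ x)) (+-identityʳ b)))

  affine-section : ∀ {g g⁻¹} → g * g⁻¹ ≈ 1# → ∀ y → 1# + (y - 1#) * g⁻¹ * g ≈ y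
  affine-section {g} {g⁻¹} gg⁻¹≈1 y = begin
    1# + (y - 1#) * g⁻¹ * g     ≈⟨ +-congˡ (trans (*-assoc (y - 1#) g⁻¹ g) (*-congˡ (trans (*-comm g⁻¹ g) gg⁻¹≈1))) ⟩
    1# + (y - 1#) * 1#          ≈⟨ +-congˡ (*-identityʳ (y - 1#)) ⟩
    1# + (y - 1#)               ≈⟨ +-assoc 1# y (- 1#) ⟨
    1# + y - 1#                 ≈⟨ xyx⁻¹≈y 1# y ⟩
    y                           ∎
    where open ≈-Reasoning

  affine-retraction : ∀ {g g⁻¹} → g * g⁻¹ ≈ 1# → ∀ x → (1# + x * g - 1#) * g⁻¹ ≈ x
  affine-retraction {g} {g⁻¹} gg⁻¹≈1 x = begin
    (1# + x * g - 1#) * g⁻¹     ≈⟨ *-congʳ (xyx⁻¹≈y 1# (x * g)) ⟩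
    x * g * g⁻¹                 ≈⟨ *-assoc x g g⁻¹ ⟩
    x * (g * g⁻¹)               ≈⟨ *-congˡ gg⁻¹≈1 ⟩
    x * 1#                      ≈⟨ *-identityʳ x ⟩
    x                           ∎
    where open ≈-Reasoning

  permutation-invariance : ∀ {u u⁻¹ g g⁻¹} D F → u⁻¹ * u ≈ 1# → g * g⁻¹ ≈ 1# →
    D ≃ scale u (compose F (1# ∷ g ∷ [])) → IsPermutationPolynomial D ⇔ IsPermutationPolynomial F
  permutation-invariance {u} {u⁻¹} {g} {g⁻¹} D F u⁻¹u≈1 gg⁻¹≈1 D≃uF∘φ = begin
    Permutes (eval D)                   ≈⟨ permutes-cong eval-D ⟩
    Permutes (λ x → u * eval F (φ x))   ≈⟨ permutes-scale u⁻¹u≈1 ⟨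
    Permutes (eval F ∘ φ)               ≈⟨ permutes-∘ (eval-congʳ F) (λ x≈y → +-congˡ (*-congʳ x≈y))
                                                      (λ x≈y → *-congʳ (+-congʳ x≈y))
                                                      (affine-section gg⁻¹≈1) (affine-retraction gg⁻¹≈1) ⟨
    Permutes (eval F)                   ∎
    where
    open ⇔-Reasoning
    φ : Carrier → Carrier
    φ x = 1# + x * g
    eval-D : ∀ x → eval D x ≈ u * eval F (φ x)
    eval-D x = trans (eval-cong x D≃uF∘φ)
              (trans (eval-scale u (compose F (1# ∷ g ∷ [])) x)
                     (*-congˡ (trans (eval-compose F (1# ∷ g ∷ []) x) (eval-congʳ F (eval-linear 1# g x)))))

module OddOrder where
  open import Relation.Binary.PropositionalEquality
  open import Data.Nat using (_^_)
  open import Data.Nat.Divisibility using (_∣_; divides; ∣1⇒≡1; ∣m∣n⇒∣m+n; ∣-refl)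
  open import Data.Nat.Primality using (euclidsLemma; prime[2]; prime⇒irreducible)
  open import Data.Fin using (Fin; zero; punchIn; punchOut)
  open import Data.Fin.Properties using (punchIn-injective; punchInᵢ≢i; punchIn-punchOut)
  open import Data.Sum using (inj₁; inj₂)
  open import Relation.Nullary using (¬_; contradiction)

  odd-prime-power : ∀ {p} m → Prime p → p ≢ 2 → ¬ (2 ∣ p ^ m)
  odd-prime-power zero    p-prime p≢2 2∣1 with () ← ∣1⇒≡1 2∣1
  odd-prime-power {p} (suc m) p-prime p≢2 2∣p^[1+m] with euclidsLemma p (p ^ m) prime[2] 2∣p^[1+m]
  ... | inj₂ 2∣p^m = odd-prime-power m p-prime p≢2 2∣p^m
  ... | inj₁ 2∣p with prime⇒irreducible p-prime 2∣p
  ...   | inj₂ 2≡p = p≢2 (sym 2≡p)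

  -- Removing the pair {0, σ 0} leaves a fixed-point-free involution on q - 2 points.
  fixedPointFree-involution⇒even : ∀ q (σ : Fin q → Fin q) →
    (∀ i → σ (σ i) ≡ i) → (∀ i → σ i ≢ i) → 2 ∣ q
  fixedPointFree-involution⇒even zero          σ σσ≡id σ≢id = divides 0 refl
  fixedPointFree-involution⇒even (suc zero)    σ σσ≡id σ≢id with σ zero in σ0≡0
  ... | zero = contradiction σ0≡0 (σ≢id zero)
  fixedPointFree-involution⇒even (suc (suc q)) σ σσ≡id σ≢id =
    ∣m∣n⇒∣m+n (∣-refl {2}) (fixedPointFree-involution⇒even q τ ττ≡id τ≢id)
    where
    0≢σ0 : zero ≢ σ zero
    0≢σ0 0≡σ0 = σ≢id zero (sym 0≡σ0)
    b : Fin (suc q)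
    b = punchOut 0≢σ0
    e : Fin q → Fin (suc (suc q))
    e x = punchIn zero (punchIn b x)
    e-injective : ∀ {x y} → e x ≡ e y → x ≡ y
    e-injective ex≡ey = punchIn-injective b _ _ (punchIn-injective zero _ _ ex≡ey)
    σ-injective : ∀ {i j} → σ i ≡ σ j → i ≡ j
    σ-injective {i} {j} σi≡σj = trans (sym (σσ≡id i)) (trans (cong σ σi≡σj) (σσ≡id j))
    0≢σe : ∀ x → zero ≢ σ (e x)
    0≢σe x 0≡σex = punchInᵢ≢i b x (punchIn-injective zero _ _ ex≡b)
      where
      ex≡b : e x ≡ punchIn zero b
      ex≡b = trans (sym (σσ≡id (e x))) (trans (cong σ (sym 0≡σex)) (sym (punchIn-punchOut 0≢σ0)))
    c : Fin q → Fin (suc q)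
    c x = punchOut (0≢σe x)
    b≡c⇒σe≡σ0 : ∀ x → b ≡ c x → σ (e x) ≡ σ zero
    b≡c⇒σe≡σ0 x b≡cx = trans (sym (punchIn-punchOut (0≢σe x)))
                              (trans (cong (punchIn zero) (sym b≡cx)) (punchIn-punchOut 0≢σ0))
    b≢c : ∀ x → b ≢ c x
    b≢c x b≡cx with () ← σ-injective (b≡c⇒σe≡σ0 x b≡cx)
    τ : Fin q → Fin q
    τ x = punchOut (b≢c x)
    eτ≡σe : ∀ x → e (τ x) ≡ σ (e x)
    eτ≡σe x = trans (cong (punchIn zero) (punchIn-punchOut (b≢c x))) (punchIn-punchOut (0≢σe x))
    ττ≡id : ∀ x → τ (τ x) ≡ x
    ττ≡id x = e-injective (trans (eτ≡σe (τ x)) (trans (cong σ (eτ≡σe x)) (σσ≡id (e x))))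
    τ≢id : ∀ x → τ x ≢ x
    τ≢id x τx≡x = σ≢id (e x) (trans (sym (eτ≡σe x)) (cong e τx≡x))

open OddOrder

module Characteristic {c ℓ} (R : CommutativeRing c ℓ) where
  open CommutativeRing R
  open OverRing R
  open import Data.Nat using (_^_)
  open import Data.Fin using (Fin)
  open import Relation.Nullary using (¬_)
  import Relation.Binary.PropositionalEquality as ≡
  open import Algebra.Properties.Group +-group using (∙-cancelˡ)
  import Relation.Binary.Reasoning.Setoid as ≈-Reasoning

  -- In characteristic 2 the translation x ↦ x + 1 is a fixed-point-free involution.
  1+1≉0 : ∀ {p q} → Prime p → p ≢ 2 → (∃ λ m → q ≡ p ^ m) → IsFiniteFieldOfOrder q → ¬ (1# + 1# ≈ 0#)
  1+1≉0 p-prime p≢2 (m , ≡.refl) F 1+1≈0 =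
    odd-prime-power m p-prime p≢2 (fixedPointFree-involution⇒even _ σ σσ≡id σ≢id)
    where
    open IsFiniteFieldOfOrder F
    open ≈-Reasoning setoid
    σ : Fin _ → Fin _
    σ i = proj₁ (enum-onto (enum i + 1#))
    enum-σ : ∀ i → enum i + 1# ≈ enum (σ i)
    enum-σ i = proj₂ (enum-onto (enum i + 1#))
    σσ≡id : ∀ i → σ (σ i) ≡ i
    σσ≡id i = enum-inj (σ (σ i)) i (begin
      enum (σ (σ i))        ≈⟨ enum-σ (σ i) ⟨
      enum (σ i) + 1#       ≈⟨ +-congʳ (enum-σ i) ⟨
      enum i + 1# + 1#      ≈⟨ +-assoc (enum i) 1# 1# ⟩
      enum i + (1# + 1#)    ≈⟨ +-congˡ 1+1≈0 ⟩
      enum i + 0#           ≈⟨ +-identityʳ (enum i) ⟩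
      enum i                ∎)
    σ≢id : ∀ i → σ i ≢ i
    σ≢id i σi≡i = nontrivial (∙-cancelˡ (enum i) 1# 0# (begin
      enum i + 1#           ≈⟨ enum-σ i ⟩
      enum (σ i)            ≡⟨ ≡.cong enum σi≡i ⟩
      enum i                ≈⟨ +-identityʳ (enum i) ⟨
      enum i + 0#           ∎))

open import Data.Nat using (_^_)

proposition3p1 : ∀ {c ℓ} (p q k n : ℕ) → Prime p → p ≢ 2 → (∃ λ m → q ≡ p ^ m)
    → (R : CommutativeRing c ℓ) → OverRing.IsFiniteFieldOfOrder R q
    → k < p → 0 < n
    → let open CommutativeRing R
          open OverRing R
      in (∀ h → h * (1# + 1#) ≈ 1#
            → reduce (DZ n k)
              ≈ᴾ PR.scale (pow h n) (PR.compose (reduce (fZ n k)) (1# ∷ ι -[1+ 3 ] ∷ [])))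
         × (IsPermutationPolynomial (reduce (DZ n k)) ⇔ IsPermutationPolynomial (reduce (fZ n k)))
proposition3p1 p q k (suc n) p-prime p≢2 q≡p^m R F _ _ =
    (λ h h2≈1 → ≈ᴾ (D≃f∘[1-4x] h h2≈1 k n))
  , permutation-invariance (reduce (DZ (suc n) k)) (reduce (fZ (suc n) k))
      (pow-inverse (suc n) 2½≈1) (ι[-4]-inverse ½2≈1) (D≃f∘[1-4x] ½ ½2≈1 k n)
  where
  open CommutativeRing R
  open OverRing R
  open PolynomialAlgebra R using (≈ᴾ)
  open Reduction R using (D≃f∘[1-4x]; pow-inverse; ι[-4]-inverse)
  open PermutationPolynomials R using (permutation-invariance)
  open IsFiniteFieldOfOrder F using (inverse)
  ½ : Carrier
  ½ = proj₁ (inverse (1# + 1#) (Characteristic.1+1≉0 R p-prime p≢2 q≡p^m F))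
  2½≈1 : (1# + 1#) * ½ ≈ 1#
  2½≈1 = proj₂ (inverse (1# + 1#) (Characteristic.1+1≉0 R p-prime p≢2 q≡p^m F))
  ½2≈1 : ½ * (1# + 1#) ≈ 1#
  ½2≈1 = trans (*-comm ½ (1# + 1#)) 2½≈1
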